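{- Let $A$ be a prime with $A\equiv 1 \pmod 4$, and write $A=a^2+b^2$ with positive integers $a,b$, $b$ odd. Then there exist nonnegative integers $l,m$ satisfying $$b(l^2-m^2)-2alm=\pm 1$$ (for one of the two signs) such that the minimal natural solution $x$ of Pell's equation $y^2-Ax^2=1$ is $$x=2\,\bigl|2blm+a(l^2-m^2)\bigr|\,(l^2+m^2).$$
   Context: For a positive integer $A$ that is not a perfect square, the minimal natural solution of Pell's equation $y^2-Ax^2=1$ is the smallest positive integer $x$ for which there is a positive integer $y$ with $y^2-Ax^2=1$ (the trivial solution $(x,y)=(0,1)$ is excluded). -}

module Defs where

open import Data.Nat using (ℕ; _+_; _*_; _≤_; _<_)
open import Data.Product using (Σ; _×_; ∃)
open import Relation.Binary.PropositionalEquality using (_≡_)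

IsPellSolution : ℕ → ℕ → Set
IsPellSolution A x = (0 < x) × ∃ λ y → (0 < y) × (y * y ≡ A * (x * x) + 1)

IsMinimalPellSolution : ℕ → ℕ → Set
IsMinimalPellSolution A x = IsPellSolution A x × (∀ x′ → IsPellSolution A x′ → x ≤ x′)

-- As √A is irrational, the pigeonhole principle applied to the fractional parts
-- of a√A, 0 ≤ a ≤ N, yields p, q with 0 < q ≤ N and |q√A − p| < 1/N, hence a nonzero norm
-- p² − Aq² of absolute value at most K = 2(⌊√A⌋ + 1).  Taking more such pairs than there are
-- values of (norm, p mod K!, q mod K!), two distinct pairs have the same norm n and are
-- congruent modulo K!, a multiple of n; then (p + q√A)(p′ − q′√A)/n is a nontrivial
-- solution X + Y√A of X² − AY² = 1.
--
-- For A ≡ 1 (mod 4), a solution of y² = Ax² + 1 has x = 2t and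
-- y = 2w + 1 with w(w + 1) = At².  Since w and w + 1 are coprime, A ∣ w would give a smaller
-- solution, so w = s², w + 1 = Ar² and x = 2sr with s² + 1 = Ar².  In ℤ[i] the prime a + bi
-- divides s + εi for a sign ε, and c + di = (s + εi)/(a + bi) satisfies c² + d² = r²,
-- cb + da = ε and ca − db = s.  Parity forces c odd and d even, so (|c|, |d|, r) is a
-- primitive Pythagorean triple (l² − m², 2lm, l² + m²); substituting into the two linear
-- relations gives the claimed identities.

module Submission where

open import Data.Empty using (⊥-elim)
open import Data.Fin as Fin using (Fin; toℕ; fromℕ<; combine)
import Data.Fin.Properties as Finₚ
open import Data.Integer as ℤ using (ℤ; +_; -_; _-_; ∣_∣; _⊖_; 0ℤ; 1ℤ) renaming (_*_ to _*ℤ_; _+_ to _+ℤ_)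
import Data.Integer.Properties as ℤₚ
import Data.Integer.Divisibility.Signed as ℤ∣
open import Data.Integer.Tactic.RingSolver using () renaming (solve to solveℤ)
open import Data.List using (_∷_; [])
open import Data.Nat hiding (∣_-_∣)
open import Data.Nat using () renaming (_*_ to _*ℕ_; _+_ to _+ℕ_)
open import Data.Nat.Coprimality using (Coprime; coprime-divisor; coprime-+; 1-coprimeTo; coprime⇒gcd≡1) renaming (sym to coprime-sym)
open import Data.Nat.DivMod
open import Data.Nat.Divisibility
open import Data.Nat.GCD
open import Data.Nat.Induction using (<-rec)
open import Data.Nat.Primality using (Prime; euclidsLemma; prime⇒nonZero; prime⇒nonTrivial)
open import Data.Nat.Properties
open import Data.Nat.Tactic.RingSolver using (solve)
open import Data.Product using (Σ; ∃; ∃₂; _×_; _,_; proj₁; proj₂)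
open import Data.Sum using (_⊎_; inj₁; inj₂)
open import Function using (_∘_)
open import Relation.Nullary using (yes; no)
open import Relation.Nullary.Decidable using (Dec; _×-dec_)
open import Relation.Binary.Definitions using (tri<; tri≈; tri>)
open import Relation.Binary.PropositionalEquality
open import Defs


m*m≤n*n⇒m≤n : ∀ {m n} → m * m ≤ n * n → m ≤ n
m*m≤n*n⇒m≤n {m} {n} m²≤n² with m ≤? n
... | yes m≤n = m≤n
... | no m≰n = ⊥-elim (<⇒≱ (*-mono-< (≰⇒> m≰n) (≰⇒> m≰n)) m²≤n²)

m*m<n*n⇒m<n : ∀ {m n} → m * m < n * n → m < n
m*m<n*n⇒m<n {m} {n} m²<n² with m <? n
... | yes m<n = m<n
... | no m≮n = ⊥-elim (<⇒≱ m²<n² (*-mono-≤ (≮⇒≥ m≮n) (≮⇒≥ m≮n)))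

m*m≡n*n⇒m≡n : ∀ {m n} → m * m ≡ n * n → m ≡ n
m*m≡n*n⇒m≡n eq = ≤-antisym (m*m≤n*n⇒m≤n (≤-reflexive eq)) (m*m≤n*n⇒m≤n (≤-reflexive (sym eq)))

n*n≡m+1⇒0<n : ∀ {n m} → n * n ≡ m + 1 → 0 < n
n*n≡m+1⇒0<n {zero} {m} 0≡m+1 = ⊥-elim (1+n≢0 (trans (+-comm 1 m) (sym 0≡m+1)))
n*n≡m+1⇒0<n {suc _} _ = z<s

pred-square<⇒square< : ∀ {x z} → (x ∸ 1) * (x ∸ 1) < z → x * x < z + 2 * x
pred-square<⇒square< {zero} {z} 0<z = subst (0 <_) (sym (+-identityʳ z)) 0<z
pred-square<⇒square< {suc t} {z} t²<z = begin-strict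
  suc t * suc t      ≡⟨ solve (t ∷ []) ⟩
  suc (t * t) + 2 * t  ≤⟨ +-monoˡ-≤ (2 * t) t²<z ⟩
  z + 2 * t          <⟨ +-monoʳ-< z (*-monoʳ-< 2 (n<1+n t)) ⟩
  z + 2 * suc t      ∎
  where open ≤-Reasoning

floor-sqrt : ∀ n → ∃ λ s → s * s ≤ n × n < suc s * suc s
floor-sqrt zero = 0 , z≤n , s≤s z≤n
floor-sqrt (suc n) with floor-sqrt n
... | s , s²≤n , n<[1+s]² with suc s * suc s ≤? suc n
...   | no [1+s]²≰1+n = s , m≤n⇒m≤1+n s²≤n , ≰⇒> [1+s]²≰1+n
...   | yes [1+s]²≤1+n = suc s , [1+s]²≤1+n , 1+n<[2+s]²
  where
  1+n<[2+s]² : suc n < suc (suc s) * suc (suc s)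
  1+n<[2+s]² = subst (_< suc (suc s) * suc (suc s)) (≤-antisym [1+s]²≤1+n n<[1+s]²)
                     (*-mono-< (n<1+n (suc s)) (n<1+n (suc s)))

⌊√_⌋ : ℕ → ℕ
⌊√ n ⌋ = proj₁ (floor-sqrt n)

⌊√n⌋*⌊√n⌋≤n : ∀ n → ⌊√ n ⌋ * ⌊√ n ⌋ ≤ n
⌊√n⌋*⌊√n⌋≤n n = proj₁ (proj₂ (floor-sqrt n))

n<[1+⌊√n⌋]*[1+⌊√n⌋] : ∀ n → n < suc ⌊√ n ⌋ * suc ⌊√ n ⌋
n<[1+⌊√n⌋]*[1+⌊√n⌋] n = proj₂ (proj₂ (floor-sqrt n))

m*m≤n⇒m≤⌊√n⌋ : ∀ {m n} → m * m ≤ n → m ≤ ⌊√ n ⌋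
m*m≤n⇒m≤⌊√n⌋ {m} {n} m²≤n = s≤s⁻¹ (m*m<n*n⇒m<n (≤-<-trans m²≤n (n<[1+⌊√n⌋]*[1+⌊√n⌋] n)))

n<m*m⇒⌊√n⌋<m : ∀ {m n} → n < m * m → ⌊√ n ⌋ < m
n<m*m⇒⌊√n⌋<m {m} {n} n<m² = m*m<n*n⇒m<n (≤-<-trans (⌊√n⌋*⌊√n⌋≤n n) n<m²)

⌊√⌋-mono-≤ : ∀ {m n} → m ≤ n → ⌊√ m ⌋ ≤ ⌊√ n ⌋
⌊√⌋-mono-≤ {m} m≤n = m*m≤n⇒m≤⌊√n⌋ (≤-trans (⌊√n⌋*⌊√n⌋≤n m) m≤n)

*-⌊√⌋≤⌊√*⌋ : ∀ c n → c * ⌊√ n ⌋ ≤ ⌊√ c * c * n ⌋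
*-⌊√⌋≤⌊√*⌋ c n = m*m≤n⇒m≤⌊√n⌋ (begin
  c * ⌊√ n ⌋ * (c * ⌊√ n ⌋)  ≡⟨ [m*n]*[o*p]≡[m*o]*[n*p] c ⌊√ n ⌋ c ⌊√ n ⌋ ⟩
  c * c * (⌊√ n ⌋ * ⌊√ n ⌋)  ≤⟨ *-monoʳ-≤ (c * c) (⌊√n⌋*⌊√n⌋≤n n) ⟩
  c * c * n                  ∎)
  where open ≤-Reasoning

⌊√*⌋<*-[1+⌊√⌋] : ∀ c n .{{_ : NonZero c}} → ⌊√ c * c * n ⌋ < c * suc ⌊√ n ⌋
⌊√*⌋<*-[1+⌊√⌋] c n = n<m*m⇒⌊√n⌋<m (begin-strict
  c * c * n                                <⟨ *-monoʳ-< (c * c) {{m*n≢0 c c}} (n<[1+⌊√n⌋]*[1+⌊√n⌋] n) ⟩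
  c * c * (suc ⌊√ n ⌋ * suc ⌊√ n ⌋)        ≡⟨ [m*n]*[o*p]≡[m*o]*[n*p] c c (suc ⌊√ n ⌋) (suc ⌊√ n ⌋) ⟩
  c * suc ⌊√ n ⌋ * (c * suc ⌊√ n ⌋)        ∎)
  where open ≤-Reasoning

m%n≡r⇒m≡r+n*[m/n] : ∀ {m n r} .{{_ : NonZero n}} → m % n ≡ r → m ≡ r + n * (m / n)
m%n≡r⇒m≡r+n*[m/n] {m} {n} {r} m%n≡r = begin
  m                  ≡⟨ m≡m%n+[m/n]*n m n ⟩
  m % n + m / n * n  ≡⟨ cong₂ _+_ m%n≡r (*-comm (m / n) n) ⟩
  r + n * (m / n)    ∎
  where open ≡-Reasoning

even⊎odd : ∀ n → (∃ λ k → n ≡ 2 * k) ⊎ (∃ λ k → n ≡ 1 + 2 * k)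
even⊎odd n with n % 2 | m%n<n n 2 | m≡m%n+[m/n]*n n 2
... | 0 | _ | n≡2k   = inj₁ (n / 2 , trans n≡2k (*-comm (n / 2) 2))
... | 1 | _ | n≡1+2k = inj₂ (n / 2 , trans n≡1+2k (cong suc (*-comm (n / 2) 2)))
... | 2+ _ | s≤s (s≤s ()) | _

square≢2+4* : ∀ n j → n * n ≢ 2 + 4 * j
square≢2+4* n j eq with even⊎odd n
... | inj₁ (k , refl) = even≢odd (k * k) j (*-cancelˡ-≡ (2 * (k * k)) (1 + 2 * j) 2 (begin
  2 * (2 * (k * k))  ≡⟨ solve (k ∷ []) ⟩
  2 * k * (2 * k)    ≡⟨ eq ⟩
  2 + 4 * j          ≡⟨ solve (j ∷ []) ⟩
  2 * (1 + 2 * j)    ∎))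
  where open ≡-Reasoning
... | inj₂ (k , refl) = even≢odd (1 + 2 * j) (2 * (k * k + k)) (begin
  2 * (1 + 2 * j)              ≡⟨ solve (j ∷ []) ⟨
  2 + 4 * j                    ≡⟨ eq ⟨
  (1 + 2 * k) * (1 + 2 * k)    ≡⟨ solve (k ∷ []) ⟩
  1 + 2 * (2 * (k * k + k))    ∎)
  where open ≡-Reasoning

Least : (ℕ → Set) → ℕ → Set
Least P m = P m × (∀ k → P k → m ≤ k)

least-witness : ∀ {P : ℕ → Set} → (∀ n → Dec (P n)) → ∀ {n} → P n → ∃ (Least P)
least-witness {P} P? {n} = <-rec (λ n → P n → ∃ (Least P)) search n
  where
  search : ∀ n → (∀ {k} → k < n → P k → ∃ (Least P)) → P n → ∃ (Least P)
  search n below Pn with anyUpTo? P? n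
  ... | yes (k , k<n , Pk) = below k<n Pk
  ... | no none = n , Pn , λ k Pk → ≮⇒≥ (λ k<n → none (k , k<n , Pk))

step-increasing⇒increasing : ∀ (f : ℕ → ℕ) → (∀ k → f k < f (suc k)) → ∀ {i j} → i < j → f i < f j
step-increasing⇒increasing f step {i} {suc j} i<1+j with m≤n⇒m<n∨m≡n (s≤s⁻¹ i<1+j)
... | inj₁ i<j  = <-trans (step-increasing⇒increasing f step i<j) (step j)
... | inj₂ refl = step j

∣n! : ∀ {d n} → 0 < d → d ≤ n → d ∣ n !
∣n! {suc k} _ 1+k≤n = ∣-trans (m∣m*n (k !)) (m≤n⇒m!∣n! 1+k≤n)


coprime-of-divisor : ∀ {m n o} → m ∣ n → Coprime n o → Coprime m o
coprime-of-divisor m∣n n⊥o (d∣m , d∣o) = n⊥o (∣-trans d∣m m∣n , d∣o)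

consecutive-coprime : ∀ n → Coprime n (suc n)
consecutive-coprime n = coprime-sym (subst (λ m → Coprime m n) (+-comm n 1) (coprime-+ (1-coprimeTo n)))

coprime-factor-of-square : ∀ {u v t} → Coprime u v → u * v ≡ t * t → u ≡ gcd u t * gcd u t
coprime-factor-of-square {u} {v} {t} u⊥v uv≡t² = ∣-antisym u∣g² g²∣u
  where
  g = gcd u t
  g²∣u : g * g ∣ u
  g²∣u = begin
    g * g                ∣⟨ gcd-greatest (*-pres-∣ (gcd[m,n]∣m u t) (gcd[m,n]∣m u t))
                                         (subst (g * g ∣_) (sym uv≡t²) (*-pres-∣ (gcd[m,n]∣n u t) (gcd[m,n]∣n u t))) ⟩
    gcd (u * u) (u * v)  ≡⟨ c*gcd[m,n]≡gcd[cm,cn] u u v ⟨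
    u * gcd u v          ≡⟨ cong (u *_) (coprime⇒gcd≡1 u⊥v) ⟩
    u * 1                ≡⟨ *-identityʳ u ⟩
    u                    ∎
    where open ∣-Reasoning
  u∣g*t : u ∣ g * t
  u∣g*t = subst (u ∣_) (trans (sym (c*gcd[m,n]≡gcd[cm,cn] t u t)) (*-comm t g))
                (gcd-greatest (n∣m*n t) (divides v (trans (sym uv≡t²) (*-comm u v))))
  u∣g² : u ∣ g * g
  u∣g² = subst (u ∣_) (sym (c*gcd[m,n]≡gcd[cm,cn] g u t)) (gcd-greatest (n∣m*n g) u∣g*t)

coprime-square-factors : ∀ {u v t} → Coprime u v → u * v ≡ t * t →
                         ∃₂ λ r s → u ≡ r * r × v ≡ s * s × t ≡ r * s
coprime-square-factors {u} {v} {t} u⊥v uv≡t² = r , s , u≡r² , v≡s² , t≡rs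
  where
  r = gcd u t
  s = gcd v t
  u≡r² = coprime-factor-of-square u⊥v uv≡t²
  v≡s² = coprime-factor-of-square (coprime-sym u⊥v) (trans (*-comm v u) uv≡t²)
  t≡rs : t ≡ r * s
  t≡rs = m*m≡n*n⇒m≡n (begin
    t * t                ≡⟨ uv≡t² ⟨
    u * v                ≡⟨ cong₂ _*_ u≡r² v≡s² ⟩
    (r * r) * (s * s)    ≡⟨ [m*n]*[o*p]≡[m*o]*[n*p] r r s s ⟩
    (r * s) * (r * s)    ∎)
    where open ≡-Reasoning


-- Irrationality of √A and Dirichlet's approximation theorem

IrrationalSqrt : ℕ → Set
IrrationalSqrt A = ∀ u v → u * u ≡ A * (v * v) → v ≡ 0

irrationalSqrt⇒nonZero : ∀ {A} → IrrationalSqrt A → NonZero A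
irrationalSqrt⇒nonZero {zero} irr with () ← irr 0 1 refl
irrationalSqrt⇒nonZero {suc A} _ = _

prime∣n*n⇒prime∣n : ∀ {p n} → Prime p → p ∣ n * n → p ∣ n
prime∣n*n⇒prime∣n {n = n} pp p∣n² with euclidsLemma n n pp p∣n²
... | inj₁ p∣n = p∣n
... | inj₂ p∣n = p∣n

square-ratio-cancel : ∀ {A u} v k .{{_ : NonZero A}} → u ≡ k * A → u * u ≡ A * (v * v) → v * v ≡ A * (k * k)
square-ratio-cancel {A} v k refl u²≡Av² = *-cancelˡ-≡ (v * v) (A * (k * k)) A (begin
  A * (v * v)        ≡⟨ u²≡Av² ⟨
  k * A * (k * A)    ≡⟨ solve (k ∷ A ∷ []) ⟩
  A * (A * (k * k))  ∎)
  where open ≡-Reasoning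

prime-square-ratio-descent : ∀ {A u v} → Prime A → u * u ≡ A * (v * v) →
                             ∃₂ λ k j → v ≡ j * A × k * k ≡ A * (j * j)
prime-square-ratio-descent {A} {u} {v} pA u²≡Av²
  with divides k u≡kA ← prime∣n*n⇒prime∣n {n = u} pA (divides (v * v) (trans u²≡Av² (*-comm A (v * v))))
  with v²≡Ak² ← square-ratio-cancel v k {{prime⇒nonZero pA}} u≡kA u²≡Av²
  with divides j v≡jA ← prime∣n*n⇒prime∣n {n = v} pA (divides (k * k) (trans v²≡Ak² (*-comm A (k * k))))
  = k , j , v≡jA , square-ratio-cancel k j {{prime⇒nonZero pA}} v≡jA v²≡Ak²

prime⇒irrationalSqrt : ∀ {A} → Prime A → IrrationalSqrt A
prime⇒irrationalSqrt {A} pA u v = <-rec (λ v → ∀ u → u * u ≡ A * (v * v) → v ≡ 0) descent v u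
  where
  descent : ∀ v → (∀ {w} → w < v → ∀ u → u * u ≡ A * (w * w) → w ≡ 0) → ∀ u → u * u ≡ A * (v * v) → v ≡ 0
  descent zero _ _ _ = refl
  descent (suc _) smaller u u²≡Av² with prime-square-ratio-descent {u = u} pA u²≡Av²
  ... | _ , zero , v≡0 , _ = v≡0
  ... | k , j@(suc _) , v≡jA , k²≡Aj²
    with () ← smaller (subst (j <_) (sym v≡jA) (m<m*n j A (nonTrivial⇒n>1 A {{prime⇒nonTrivial pA}}))) k k²≡Aj²

-- u ≤ v√A is written u * u ≤ A * (v * v), and similarly for the other comparisons.
*-≤√ : ∀ {A a b c d} → a * a ≤ A * (b * b) → c * c ≤ A * (d * d) → a * c ≤ A * (b * d)
*-≤√ {A} {a} {b} {c} {d} a≤b√A c≤d√A = m*m≤n*n⇒m≤n (begin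
  a * c * (a * c)              ≡⟨ [m*n]*[o*p]≡[m*o]*[n*p] a c a c ⟩
  a * a * (c * c)              ≤⟨ *-mono-≤ a≤b√A c≤d√A ⟩
  A * (b * b) * (A * (d * d))  ≡⟨ solve (A ∷ b ∷ d ∷ []) ⟩
  A * (b * d) * (A * (b * d))  ∎)
  where open ≤-Reasoning

*-√≤ : ∀ {A a b c d} → A * (b * b) ≤ a * a → A * (d * d) ≤ c * c → A * (b * d) ≤ a * c
*-√≤ {A} {a} {b} {c} {d} b√A≤a d√A≤c = m*m≤n*n⇒m≤n (begin
  A * (b * d) * (A * (b * d))  ≡⟨ solve (A ∷ b ∷ d ∷ []) ⟩
  A * (b * b) * (A * (d * d))  ≤⟨ *-mono-≤ b√A≤a d√A≤c ⟩
  a * a * (c * c)              ≡⟨ [m*n]*[o*p]≡[m*o]*[n*p] a c a c ⟨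
  a * c * (a * c)              ∎)
  where open ≤-Reasoning

+-≤√ : ∀ {A u₁ u₂ v₁ v₂} → u₁ * u₁ ≤ A * (v₁ * v₁) → u₂ * u₂ ≤ A * (v₂ * v₂) →
       (u₁ + u₂) * (u₁ + u₂) ≤ A * ((v₁ + v₂) * (v₁ + v₂))
+-≤√ {A} {u₁} {u₂} {v₁} {v₂} h₁ h₂ = begin
  (u₁ + u₂) * (u₁ + u₂)                                ≡⟨ solve (u₁ ∷ u₂ ∷ []) ⟩
  u₁ * u₁ + 2 * (u₁ * u₂) + u₂ * u₂                    ≤⟨ +-mono-≤ (+-mono-≤ h₁ (*-monoʳ-≤ 2 (*-≤√ {A} {u₁} {v₁} {u₂} {v₂} h₁ h₂))) h₂ ⟩
  A * (v₁ * v₁) + 2 * (A * (v₁ * v₂)) + A * (v₂ * v₂)  ≡⟨ solve (A ∷ v₁ ∷ v₂ ∷ []) ⟩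
  A * ((v₁ + v₂) * (v₁ + v₂))                          ∎
  where open ≤-Reasoning

+-√< : ∀ {A u₁ u₂ v₁ v₂} → A * (v₁ * v₁) < u₁ * u₁ → A * (v₂ * v₂) ≤ u₂ * u₂ →
       A * ((v₁ + v₂) * (v₁ + v₂)) < (u₁ + u₂) * (u₁ + u₂)
+-√< {A} {u₁} {u₂} {v₁} {v₂} h₁ h₂ = begin-strict
  A * ((v₁ + v₂) * (v₁ + v₂))                          ≡⟨ solve (A ∷ v₁ ∷ v₂ ∷ []) ⟩
  A * (v₁ * v₁) + 2 * (A * (v₁ * v₂)) + A * (v₂ * v₂)  <⟨ +-mono-<-≤ (+-mono-<-≤ h₁ (*-monoʳ-≤ 2 (*-√≤ {A} {u₁} {v₁} {u₂} {v₂} (<⇒≤ h₁) h₂))) h₂ ⟩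
  u₁ * u₁ + 2 * (u₁ * u₂) + u₂ * u₂                    ≡⟨ solve (u₁ ∷ u₂ ∷ []) ⟩
  (u₁ + u₂) * (u₁ + u₂)                                ∎
  where open ≤-Reasoning

⌊_·√_⌋ : ℕ → ℕ → ℕ
⌊ v ·√ A ⌋ = ⌊√ A * (v * v) ⌋

⌊·√⌋-difference-upper : ∀ {A w v x} → ⌊ w + v ·√ A ⌋ ≡ ⌊ w ·√ A ⌋ + x → A * (v * v) < suc x * suc x
⌊·√⌋-difference-upper {A} {w} {v} {x} ⌊w+v⌋≡⌊w⌋+x = ≰⇒> λ 1+x≤v√A →
  <⇒≱ (n<[1+⌊√n⌋]*[1+⌊√n⌋] (A * ((w + v) * (w + v))))
      (subst (λ u → u * u ≤ A * ((w + v) * (w + v))) 1+⌊w⌋+x≡1+⌊w+v⌋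
             (+-≤√ {A} {⌊ w ·√ A ⌋} {suc x} {w} {v} (⌊√n⌋*⌊√n⌋≤n (A * (w * w))) 1+x≤v√A))
  where
  1+⌊w⌋+x≡1+⌊w+v⌋ : ⌊ w ·√ A ⌋ + suc x ≡ suc ⌊ w + v ·√ A ⌋
  1+⌊w⌋+x≡1+⌊w+v⌋ = trans (+-suc ⌊ w ·√ A ⌋ x) (cong suc (sym ⌊w+v⌋≡⌊w⌋+x))

⌊·√⌋-difference-lower : ∀ {A w v x} → 0 < A * (v * v) → ⌊ w + v ·√ A ⌋ ≡ ⌊ w ·√ A ⌋ + x →
                        (x ∸ 1) * (x ∸ 1) < A * (v * v)
⌊·√⌋-difference-lower {x = zero} 0<v√A _ = 0<v√A
⌊·√⌋-difference-lower {A} {w} {v} {suc y} _ ⌊w+v⌋≡⌊w⌋+1+y = ≰⇒> λ v√A≤y →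
  <⇒≱ (subst (λ u → A * ((w + v) * (w + v)) < u * u) 1+⌊w⌋+y≡⌊w+v⌋
             (+-√< {A} {suc ⌊ w ·√ A ⌋} {y} {w} {v} (n<[1+⌊√n⌋]*[1+⌊√n⌋] (A * (w * w))) v√A≤y))
      (⌊√n⌋*⌊√n⌋≤n (A * ((w + v) * (w + v))))
  where
  1+⌊w⌋+y≡⌊w+v⌋ : suc ⌊ w ·√ A ⌋ + y ≡ ⌊ w + v ·√ A ⌋
  1+⌊w⌋+y≡⌊w+v⌋ = trans (sym (+-suc ⌊ w ·√ A ⌋ y)) (sym ⌊w+v⌋≡⌊w⌋+1+y)

⌊*·√⌋≡⌊√*⌋ : ∀ A N a → ⌊ N * a ·√ A ⌋ ≡ ⌊√ N * N * (A * (a * a)) ⌋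
⌊*·√⌋≡⌊√*⌋ A N a = cong ⌊√_⌋ {x = A * (N * a * (N * a))} {y = N * N * (A * (a * a))} (solve (A ∷ N ∷ a ∷ []))

*-⌊·√⌋≤⌊*·√⌋ : ∀ A N a → N * ⌊ a ·√ A ⌋ ≤ ⌊ N * a ·√ A ⌋
*-⌊·√⌋≤⌊*·√⌋ A N a = subst (N * ⌊ a ·√ A ⌋ ≤_) (sym (⌊*·√⌋≡⌊√*⌋ A N a)) (*-⌊√⌋≤⌊√*⌋ N (A * (a * a)))

⌊*·√⌋<*-[1+⌊·√⌋] : ∀ A N a .{{_ : NonZero N}} → ⌊ N * a ·√ A ⌋ < N * suc ⌊ a ·√ A ⌋
⌊*·√⌋<*-[1+⌊·√⌋] A N a = subst (_< N * suc ⌊ a ·√ A ⌋) (sym (⌊*·√⌋≡⌊√*⌋ A N a)) (⌊√*⌋<*-[1+⌊√⌋] N (A * (a * a)))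

-- The index k with k/N ≤ frac(a√A) < (k+1)/N.
box : ℕ → ℕ → ℕ → ℕ
box A N a = ⌊ N * a ·√ A ⌋ ∸ N * ⌊ a ·√ A ⌋

⌊*·√⌋≡box+*⌊·√⌋ : ∀ A N a → ⌊ N * a ·√ A ⌋ ≡ box A N a + N * ⌊ a ·√ A ⌋
⌊*·√⌋≡box+*⌊·√⌋ A N a = sym (m∸n+n≡m (*-⌊·√⌋≤⌊*·√⌋ A N a))

-- Opaque because unfolding this proof under fromℕ< in dirichlet makes type checking very slow.
opaque
  box<N : ∀ A N a .{{_ : NonZero N}} → box A N a < N
  box<N A N a = +-cancelʳ-< (N * ⌊ a ·√ A ⌋) (box A N a) N (begin-strict
    box A N a + N * ⌊ a ·√ A ⌋  ≡⟨ ⌊*·√⌋≡box+*⌊·√⌋ A N a ⟨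
    ⌊ N * a ·√ A ⌋              <⟨ ⌊*·√⌋<*-[1+⌊·√⌋] A N a ⟩
    N * suc ⌊ a ·√ A ⌋          ≡⟨ *-suc N ⌊ a ·√ A ⌋ ⟩
    N + N * ⌊ a ·√ A ⌋          ∎)
    where open ≤-Reasoning

same-box⇒floor-difference : ∀ A N a q → box A N (a + q) ≡ box A N a →
  ⌊ N * a + N * q ·√ A ⌋ ≡ ⌊ N * a ·√ A ⌋ + N * (⌊ a + q ·√ A ⌋ ∸ ⌊ a ·√ A ⌋)
same-box⇒floor-difference A N a q same = begin
  ⌊ N * a + N * q ·√ A ⌋                  ≡⟨ cong ⌊_·√ A ⌋ (*-distribˡ-+ N a q) ⟨
  ⌊ N * (a + q) ·√ A ⌋                    ≡⟨ ⌊*·√⌋≡box+*⌊·√⌋ A N (a + q) ⟩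
  box A N (a + q) + N * ⌊ a + q ·√ A ⌋    ≡⟨ cong₂ (λ b f → b + N * f) same (sym (m+[n∸m]≡n ⌊a⌋≤⌊a+q⌋)) ⟩
  box A N a + N * (⌊ a ·√ A ⌋ + p)        ≡⟨ cong (λ n → box A N a + n) (*-distribˡ-+ N ⌊ a ·√ A ⌋ p) ⟩
  box A N a + (N * ⌊ a ·√ A ⌋ + N * p)    ≡⟨ +-assoc (box A N a) (N * ⌊ a ·√ A ⌋) (N * p) ⟨
  box A N a + N * ⌊ a ·√ A ⌋ + N * p      ≡⟨ cong (_+ N * p) (⌊*·√⌋≡box+*⌊·√⌋ A N a) ⟨
  ⌊ N * a ·√ A ⌋ + N * p                  ∎
  where
  open ≡-Reasoning
  p = ⌊ a + q ·√ A ⌋ ∸ ⌊ a ·√ A ⌋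
  ⌊a⌋≤⌊a+q⌋ : ⌊ a ·√ A ⌋ ≤ ⌊ a + q ·√ A ⌋
  ⌊a⌋≤⌊a+q⌋ = ⌊√⌋-mono-≤ (*-monoʳ-≤ A (*-mono-≤ (m≤m+n a q) (m≤m+n a q)))

-- |q√A − p| < 1/N, stated as Np − 1 < Nq√A < Np + 1 between squares.
WithinOneOver : ℕ → ℕ → ℕ → ℕ → Set
WithinOneOver A N p q = (N * p ∸ 1) * (N * p ∸ 1) < A * (N * q * (N * q))
                      × A * (N * q * (N * q)) < suc (N * p) * suc (N * p)

dirichlet : ∀ A .{{_ : NonZero A}} N .{{_ : NonZero N}} → ∃₂ λ p q → 0 < q × q ≤ N × WithinOneOver A N p q
dirichlet A N with Finₚ.pigeonhole (n<1+n N) (λ i → fromℕ< (box<N A N (toℕ i)))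
... | i , j , i<j , same-index = p , q , 0<q , q≤N , lower , upper
  where
  a = toℕ i
  q = toℕ j ∸ a
  p = ⌊ a + q ·√ A ⌋ ∸ ⌊ a ·√ A ⌋
  j≡a+q : toℕ j ≡ a + q
  j≡a+q = sym (m+[n∸m]≡n (<⇒≤ i<j))
  0<q : 0 < q
  0<q = m<n⇒0<n∸m i<j
  q≤N : q ≤ N
  q≤N = ≤-trans (m∸n≤m (toℕ j) a) (s≤s⁻¹ (Finₚ.toℕ<n j))
  same-box : box A N (a + q) ≡ box A N a
  same-box = trans (cong (box A N) (sym j≡a+q)) (Finₚ.fromℕ<-injective _ _ _ _ (sym same-index))
  difference = same-box⇒floor-difference A N a q same-box
  upper = ⌊·√⌋-difference-upper {A} {N * a} {N * q} difference
  0<Nq : 0 < N * q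
  0<Nq = *-mono-≤ (>-nonZero⁻¹ N) 0<q
  lower = ⌊·√⌋-difference-lower {A} {N * a} {N * q} (*-mono-≤ (>-nonZero⁻¹ A) (*-mono-≤ 0<Nq 0<Nq)) difference


-- Existence of a solution of Pell's equation

-- INLINE lets the ring solver see through norm.
norm : ℤ → ℤ → ℤ → ℤ
norm A x y = x *ℤ x - A *ℤ (y *ℤ y)
{-# INLINE norm #-}

norm-ℕ : ∀ A p q → norm (+ A) (+ p) (+ q) ≡ p * p ⊖ A * (q * q)
norm-ℕ A p q = begin
  + p *ℤ + p - + A *ℤ (+ q *ℤ + q)  ≡⟨ cong₂ _-_ (ℤₚ.pos-* p p) (cong (λ z → + A *ℤ z) (ℤₚ.pos-* q q)) ⟨
  + (p * p) - + A *ℤ + (q * q)      ≡⟨ cong (λ z → + (p * p) - z) (ℤₚ.pos-* A (q * q)) ⟨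
  + (p * p) - + (A * (q * q))       ≡⟨ ℤₚ.m-n≡m⊖n (p * p) (A * (q * q)) ⟩
  p * p ⊖ A * (q * q)               ∎
  where open ≡-Reasoning

within-one-over⇒norm-bounds : ∀ {A N p q} .{{_ : NonZero N}} → WithinOneOver A N p q →
  N * (A * (q * q)) ≤ N * (p * p) + 2 * p × N * (p * p) < N * (A * (q * q)) + 2 * p
within-one-over⇒norm-bounds {A} {N} {p} {q} (lower , upper) = *-cancelˡ-≤ N Aq²-bound , *-cancelˡ-< N _ _ p²-bound
  where
  open ≤-Reasoning
  Aq²-bound : N * (N * (A * (q * q))) ≤ N * (N * (p * p) + 2 * p)
  Aq²-bound = s≤s⁻¹ (begin-strict
    N * (N * (A * (q * q)))          ≡⟨ solve (N ∷ A ∷ q ∷ []) ⟩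
    A * (N * q * (N * q))            <⟨ upper ⟩
    suc (N * p) * suc (N * p)        ≡⟨ solve (N ∷ p ∷ []) ⟩
    suc (N * (N * (p * p) + 2 * p))  ∎)
  p²-bound : N * (N * (p * p)) < N * (N * (A * (q * q)) + 2 * p)
  p²-bound = begin-strict
    N * (N * (p * p))                              ≡⟨ solve (N ∷ p ∷ []) ⟩
    N * p * (N * p)                                <⟨ pred-square<⇒square< {N * p} lower ⟩
    A * (N * q * (N * q)) + 2 * (N * p)            ≡⟨ solve (N ∷ A ∷ q ∷ p ∷ []) ⟩
    N * (N * (A * (q * q)) + 2 * p)                ∎

within-one-over⇒p≤ : ∀ {A N p q} .{{_ : NonZero N}} → WithinOneOver A N p q → q ≤ N → p ≤ suc ⌊√ A ⌋ * N
within-one-over⇒p≤ {A} {N} {p} {q} (lower , _) q≤N = *-cancelˡ-≤ N (begin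
  N * p                        ≤⟨ m≤n+m∸n (N * p) 1 ⟩
  suc (N * p ∸ 1)              ≤⟨ m*m<n*n⇒m<n pred-bound ⟩
  suc ⌊√ A ⌋ * (N * N)         ≡⟨ trans (sym (*-assoc (suc ⌊√ A ⌋) N N)) (*-comm (suc ⌊√ A ⌋ * N) N) ⟩
  N * (suc ⌊√ A ⌋ * N)         ∎)
  where
  open ≤-Reasoning
  pred-bound : (N * p ∸ 1) * (N * p ∸ 1) < suc ⌊√ A ⌋ * (N * N) * (suc ⌊√ A ⌋ * (N * N))
  pred-bound = begin-strict
    (N * p ∸ 1) * (N * p ∸ 1)                       <⟨ lower ⟩
    A * (N * q * (N * q))                           ≤⟨ *-monoʳ-≤ A (*-mono-≤ (*-monoʳ-≤ N q≤N) (*-monoʳ-≤ N q≤N)) ⟩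
    A * (N * N * (N * N))                           <⟨ *-monoˡ-< (N * N * (N * N)) {{N⁴≢0}} (n<[1+⌊√n⌋]*[1+⌊√n⌋] A) ⟩
    suc ⌊√ A ⌋ * suc ⌊√ A ⌋ * (N * N * (N * N))     ≡⟨ [m*n]*[o*p]≡[m*o]*[n*p] (suc ⌊√ A ⌋) (suc ⌊√ A ⌋) (N * N) (N * N) ⟩
    suc ⌊√ A ⌋ * (N * N) * (suc ⌊√ A ⌋ * (N * N))   ∎
    where N⁴≢0 = m*n≢0 (N * N) (N * N) {{m*n≢0 N N}} {{m*n≢0 N N}}

close-approximation⇒small-norm : ∀ {A N p q} → IrrationalSqrt A → 0 < q →
  N * (A * (q * q)) ≤ N * (p * p) + 2 * p → N * (p * p) < N * (A * (q * q)) + 2 * p →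
  ∃ λ d → 0 < d × N * d ≤ 2 * p × (norm (+ A) (+ p) (+ q) ≡ - + d ⊎ norm (+ A) (+ p) (+ q) ≡ + d)
close-approximation⇒small-norm {A} {N} {p} {q} irr 0<q Aq²-bound p²-bound with <-cmp (p * p) (A * (q * q))
... | tri< p²<Aq² _ _ = A * (q * q) ∸ p * p , m<n⇒0<n∸m p²<Aq² , +-cancelˡ-≤ (N * (p * p)) _ _ (begin
  N * (p * p) + N * (A * (q * q) ∸ p * p)  ≡⟨ *-distribˡ-+ N (p * p) _ ⟨
  N * (p * p + (A * (q * q) ∸ p * p))      ≡⟨ cong (N *_) (m+[n∸m]≡n (<⇒≤ p²<Aq²)) ⟩
  N * (A * (q * q))                        ≤⟨ Aq²-bound ⟩
  N * (p * p) + 2 * p                      ∎) , inj₁ (trans (norm-ℕ A p q) (ℤₚ.⊖-≤ (<⇒≤ p²<Aq²)))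
  where open ≤-Reasoning
... | tri≈ _ p²≡Aq² _ = ⊥-elim (<⇒≢ 0<q (sym (irr p q p²≡Aq²)))
... | tri> _ _ Aq²<p² = p * p ∸ A * (q * q) , m<n⇒0<n∸m Aq²<p² , <⇒≤ (+-cancelˡ-< (N * (A * (q * q))) _ _ (begin-strict
  N * (A * (q * q)) + N * (p * p ∸ A * (q * q))  ≡⟨ *-distribˡ-+ N (A * (q * q)) _ ⟨
  N * (A * (q * q) + (p * p ∸ A * (q * q)))      ≡⟨ cong (N *_) (m+[n∸m]≡n (<⇒≤ Aq²<p²)) ⟩
  N * (p * p)                                    <⟨ p²-bound ⟩
  N * (A * (q * q)) + 2 * p                      ∎)) , inj₂ (trans (norm-ℕ A p q) (ℤₚ.⊖-≥ (<⇒≤ Aq²<p²)))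
  where open ≤-Reasoning

record BoundedNormPair (A K : ℕ) : Set where
  field
    p q d : ℕ
    0<q : 0 < q
    0<d : 0 < d
    d≤K : d ≤ K
    norm≡∓d : norm (+ A) (+ p) (+ q) ≡ - + d ⊎ norm (+ A) (+ p) (+ q) ≡ + d

N*d≤2p⇒p≤sN⇒d≤2s : ∀ {N d p s} .{{_ : NonZero N}} → N * d ≤ 2 * p → p ≤ s * N → d ≤ 2 * s
N*d≤2p⇒p≤sN⇒d≤2s {N} {d} {p} {s} Nd≤2p p≤sN = *-cancelˡ-≤ N (begin
  N * d        ≤⟨ Nd≤2p ⟩
  2 * p        ≤⟨ *-monoʳ-≤ 2 p≤sN ⟩
  2 * (s * N)  ≡⟨ solve (s ∷ N ∷ []) ⟩
  N * (2 * s)  ∎)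
  where open ≤-Reasoning

bounded-norm-pair : ∀ A → IrrationalSqrt A → ∀ N .{{_ : NonZero N}} →
                    Σ (BoundedNormPair A (2 * suc ⌊√ A ⌋)) λ P → N ≤ 2 * BoundedNormPair.p P
bounded-norm-pair A irr N = from-approximation (dirichlet A {{irrationalSqrt⇒nonZero irr}} N)
  where
  from-approximation : (∃₂ λ p q → 0 < q × q ≤ N × WithinOneOver A N p q) →
                       Σ (BoundedNormPair A (2 * suc ⌊√ A ⌋)) λ P → N ≤ 2 * BoundedNormPair.p P
  from-approximation (p , q , 0<q , q≤N , within) =
    let Aq²-bound , p²-bound = within-one-over⇒norm-bounds {A} {N} {p} {q} within
        d , 0<d , Nd≤2p , norm≡∓d = close-approximation⇒small-norm {A} {N} {p} {q} irr 0<q Aq²-bound p²-bound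
    in record { p = p ; q = q ; d = d ; 0<q = 0<q ; 0<d = 0<d
              ; d≤K = N*d≤2p⇒p≤sN⇒d≤2s Nd≤2p (within-one-over⇒p≤ {A} {N} {p} {q} within q≤N) ; norm≡∓d = norm≡∓d }
       , ≤-trans (m≤m*n N d {{>-nonZero 0<d}}) Nd≤2p

-- Since N ≤ 2p, taking N = 2p + 1 for the next pair makes p strictly increase.
bounded-norm-pairs : ∀ A → IrrationalSqrt A → ℕ → BoundedNormPair A (2 * suc ⌊√ A ⌋)
bounded-norm-pairs A irr zero    = proj₁ (bounded-norm-pair A irr 1)
bounded-norm-pairs A irr (suc k) = proj₁ (bounded-norm-pair A irr (suc (2 * BoundedNormPair.p (bounded-norm-pairs A irr k))))

bounded-norm-pairs-increasing : ∀ A (irr : IrrationalSqrt A) k →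
  BoundedNormPair.p (bounded-norm-pairs A irr k) < BoundedNormPair.p (bounded-norm-pairs A irr (suc k))
bounded-norm-pairs-increasing A irr k =
  *-cancelˡ-< 2 _ _ (proj₂ (bounded-norm-pair A irr (suc (2 * BoundedNormPair.p (bounded-norm-pairs A irr k)))))

brahmagupta : ∀ A P Q P′ Q′ →
  norm A (P *ℤ P′ - A *ℤ (Q *ℤ Q′)) (P *ℤ Q′ - P′ *ℤ Q) ≡ norm A P Q *ℤ norm A P′ Q′
brahmagupta A P Q P′ Q′ = solveℤ (A ∷ P ∷ Q ∷ P′ ∷ Q′ ∷ [])

norm-scale : ∀ A c x y → c *ℤ c *ℤ norm A x y ≡ norm A (c *ℤ x) (c *ℤ y)
norm-scale A c x y = solveℤ (A ∷ c ∷ x ∷ y ∷ [])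

-- X + Y√A = (P + Q√A)(P′ − Q′√A)/n.
pell-from-equal-norms : ∀ A P Q P′ Q′ n t u .{{_ : ℤ.NonZero n}} → norm A P Q ≡ n → norm A P′ Q′ ≡ n →
  P ≡ P′ +ℤ n *ℤ t → Q ≡ Q′ +ℤ n *ℤ u → ∃₂ λ X Y → norm A X Y ≡ 1ℤ × n *ℤ Y ≡ P *ℤ Q′ - P′ *ℤ Q
pell-from-equal-norms A P Q P′ Q′ n t u N≡n N′≡n refl refl = X , Y , N[X,Y]≡1 , nY≡
  where
  open ≡-Reasoning
  X = 1ℤ +ℤ (t *ℤ P′ - A *ℤ (u *ℤ Q′))
  Y = t *ℤ Q′ - u *ℤ P′
  nX≡ : n *ℤ X ≡ P *ℤ P′ - A *ℤ (Q *ℤ Q′)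
  nX≡ = begin
    n *ℤ (1ℤ +ℤ (t *ℤ P′ - A *ℤ (u *ℤ Q′)))           ≡⟨ solveℤ (n ∷ t ∷ P′ ∷ A ∷ u ∷ Q′ ∷ []) ⟩
    n +ℤ n *ℤ (t *ℤ P′ - A *ℤ (u *ℤ Q′))               ≡⟨ cong (_+ℤ n *ℤ (t *ℤ P′ - A *ℤ (u *ℤ Q′))) N′≡n ⟨
    norm A P′ Q′ +ℤ n *ℤ (t *ℤ P′ - A *ℤ (u *ℤ Q′))   ≡⟨ solveℤ (n ∷ t ∷ P′ ∷ A ∷ u ∷ Q′ ∷ []) ⟩
    (P′ +ℤ n *ℤ t) *ℤ P′ - A *ℤ ((Q′ +ℤ n *ℤ u) *ℤ Q′) ∎
  nY≡ : n *ℤ (t *ℤ Q′ - u *ℤ P′) ≡ P *ℤ Q′ - P′ *ℤ Q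
  nY≡ = solveℤ (n ∷ t ∷ Q′ ∷ u ∷ P′ ∷ [])
  N[X,Y]≡1 : norm A X Y ≡ 1ℤ
  N[X,Y]≡1 = ℤₚ.*-cancelˡ-≡ (n *ℤ n) _ _ {{ℤₚ.i*j≢0 n n}} (begin
    n *ℤ n *ℤ norm A X Y                                 ≡⟨ norm-scale A n X Y ⟩
    norm A (n *ℤ X) (n *ℤ Y)                             ≡⟨ cong₂ (norm A) nX≡ nY≡ ⟩
    norm A (P *ℤ P′ - A *ℤ (Q *ℤ Q′)) (P *ℤ Q′ - P′ *ℤ Q) ≡⟨ brahmagupta A P Q P′ Q′ ⟩
    norm A P Q *ℤ norm A P′ Q′                           ≡⟨ cong₂ _*ℤ_ N≡n N′≡n ⟩
    n *ℤ n                                               ≡⟨ ℤₚ.*-identityʳ (n *ℤ n) ⟨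
    n *ℤ n *ℤ 1ℤ                                         ∎)

equal-norms⇒equal-squares : ∀ A P Q P′ Q′ n .{{_ : ℤ.NonZero n}} → norm A P Q ≡ n → norm A P′ Q′ ≡ n →
                            P *ℤ Q′ ≡ P′ *ℤ Q → Q *ℤ Q ≡ Q′ *ℤ Q′
equal-norms⇒equal-squares A P Q P′ Q′ n N≡n N′≡n PQ′≡P′Q = ℤₚ.*-cancelˡ-≡ n _ _ (begin
  n *ℤ (Q *ℤ Q)                                       ≡⟨ cong (_*ℤ (Q *ℤ Q)) N′≡n ⟨
  norm A P′ Q′ *ℤ (Q *ℤ Q)                            ≡⟨ solveℤ (A ∷ P′ ∷ Q′ ∷ Q ∷ []) ⟩
  (P′ *ℤ Q) *ℤ (P′ *ℤ Q) - A *ℤ (Q *ℤ Q *ℤ (Q′ *ℤ Q′)) ≡⟨ cong (λ z → z *ℤ z - A *ℤ (Q *ℤ Q *ℤ (Q′ *ℤ Q′))) PQ′≡P′Q ⟨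
  (P *ℤ Q′) *ℤ (P *ℤ Q′) - A *ℤ (Q *ℤ Q *ℤ (Q′ *ℤ Q′)) ≡⟨ solveℤ (A ∷ P ∷ Q′ ∷ Q ∷ []) ⟩
  norm A P Q *ℤ (Q′ *ℤ Q′)                            ≡⟨ cong (_*ℤ (Q′ *ℤ Q′)) N≡n ⟩
  n *ℤ (Q′ *ℤ Q′)                                     ∎)
  where open ≡-Reasoning

square-∣∣ : ∀ x → x *ℤ x ≡ + (∣ x ∣ * ∣ x ∣)
square-∣∣ (+ n)     = sym (ℤₚ.pos-* n n)
square-∣∣ ℤ.-[1+ n ] = refl

pell-solution : ∀ {A x y} → 0 < x → y * y ≡ A * (x * x) + 1 → IsPellSolution A x
pell-solution {y = y} 0<x y²≡Ax²+1 = 0<x , y , n*n≡m+1⇒0<n y²≡Ax²+1 , y²≡Ax²+1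

pell-solution-from-ℤ : ∀ {A X Y} → norm (+ A) X Y ≡ 1ℤ → Y ≢ 0ℤ → IsPellSolution A ∣ Y ∣
pell-solution-from-ℤ {A} {X} {Y} N≡1 Y≢0 =
  pell-solution {A} {∣ Y ∣} {∣ X ∣} (n≢0⇒n>0 (Y≢0 ∘ ℤₚ.∣i∣≡0⇒i≡0)) (ℤₚ.+-injective (begin
  + (∣ X ∣ * ∣ X ∣)                        ≡⟨ square-∣∣ X ⟨
  X *ℤ X                                   ≡⟨ x≡x-y+y (X *ℤ X) (+ A *ℤ (Y *ℤ Y)) ⟩
  norm (+ A) X Y +ℤ + A *ℤ (Y *ℤ Y)        ≡⟨ cong₂ (λ n y → n +ℤ + A *ℤ y) N≡1 (square-∣∣ Y) ⟩
  1ℤ +ℤ + A *ℤ + (∣ Y ∣ * ∣ Y ∣)           ≡⟨ ℤₚ.+-comm 1ℤ (+ A *ℤ + (∣ Y ∣ * ∣ Y ∣)) ⟩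
  + A *ℤ + (∣ Y ∣ * ∣ Y ∣) +ℤ 1ℤ           ≡⟨ cong (_+ℤ 1ℤ) (ℤₚ.pos-* A (∣ Y ∣ * ∣ Y ∣)) ⟨
  + (A * (∣ Y ∣ * ∣ Y ∣)) +ℤ 1ℤ            ≡⟨ ℤₚ.pos-+ (A * (∣ Y ∣ * ∣ Y ∣)) 1 ⟨
  + (A * (∣ Y ∣ * ∣ Y ∣) + 1)              ∎))
  where
  open ≡-Reasoning
  x≡x-y+y : ∀ x y → x ≡ x - y +ℤ y
  x≡x-y+y x y = solveℤ (x ∷ y ∷ [])

+-decomposition : ∀ m L .{{_ : NonZero L}} → + m ≡ + (m % L) +ℤ + (m / L) *ℤ + L
+-decomposition m L = begin
  + m                           ≡⟨ cong +_ (m≡m%n+[m/n]*n m L) ⟩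
  + (m % L + m / L * L)         ≡⟨ ℤₚ.pos-+ (m % L) (m / L * L) ⟩
  + (m % L) +ℤ + (m / L * L)    ≡⟨ cong (+ (m % L) +ℤ_) (ℤₚ.pos-* (m / L) L) ⟩
  + (m % L) +ℤ + (m / L) *ℤ + L ∎
  where open ≡-Reasoning

%-≡⇒≡+* : ∀ {m m′ L} .{{_ : NonZero L}} → m % L ≡ m′ % L → + m ≡ + m′ +ℤ + L *ℤ (+ (m / L) - + (m′ / L))
%-≡⇒≡+* {m} {m′} {L} m≡m′ = begin
  + m                                                         ≡⟨ +-decomposition m L ⟩
  + (m % L) +ℤ + (m / L) *ℤ + L                               ≡⟨ cong (λ r → + r +ℤ + (m / L) *ℤ + L) m≡m′ ⟩
  + (m′ % L) +ℤ + (m / L) *ℤ + L                              ≡⟨ shift (+ (m′ % L)) (+ (m / L)) (+ (m′ / L)) (+ L) ⟩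
  + (m′ % L) +ℤ + (m′ / L) *ℤ + L +ℤ + L *ℤ (+ (m / L) - + (m′ / L)) ≡⟨ cong (_+ℤ + L *ℤ (+ (m / L) - + (m′ / L))) (+-decomposition m′ L) ⟨
  + m′ +ℤ + L *ℤ (+ (m / L) - + (m′ / L))                     ∎
  where
  open ≡-Reasoning
  shift : ∀ r a b l → r +ℤ a *ℤ l ≡ r +ℤ b *ℤ l +ℤ l *ℤ (a - b)
  shift r a b l = solveℤ (r ∷ a ∷ b ∷ l ∷ [])

pell-from-congruent-pairs : ∀ {A p q p′ q′ n L} .{{_ : ℤ.NonZero n}} .{{_ : NonZero L}} → n ℤ∣.∣ + L →
  norm (+ A) (+ p) (+ q) ≡ n → norm (+ A) (+ p′) (+ q′) ≡ n → p % L ≡ p′ % L → q % L ≡ q′ % L →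
  0 < q → p < p′ → ∃ (IsPellSolution A)
pell-from-congruent-pairs {A} {p} {q} {p′} {q′} {n} {L} (ℤ∣.divides w L≡wn) N≡n N′≡n p≡ₘp′ q≡ₘq′ 0<q p<p′ =
  let X , Y , N[X,Y]≡1 , nY≡ = pell-from-equal-norms (+ A) (+ p) (+ q) (+ p′) (+ q′) n _ _ N≡n N′≡n
                                                     (congruent p≡ₘp′) (congruent q≡ₘq′)
  in ∣ Y ∣ , pell-solution-from-ℤ {A} {X} {Y} N[X,Y]≡1 (Y≢0 nY≡)
  where
  congruent : ∀ {m m′} → m % L ≡ m′ % L → + m ≡ + m′ +ℤ n *ℤ (w *ℤ (+ (m / L) - + (m′ / L)))
  congruent {m} {m′} m≡m′ = trans (%-≡⇒≡+* m≡m′) (cong (+ m′ +ℤ_) (begin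
    + L *ℤ (+ (m / L) - + (m′ / L))        ≡⟨ cong (_*ℤ (+ (m / L) - + (m′ / L))) L≡wn ⟩
    w *ℤ n *ℤ (+ (m / L) - + (m′ / L))     ≡⟨ reassociate w n (+ (m / L) - + (m′ / L)) ⟩
    n *ℤ (w *ℤ (+ (m / L) - + (m′ / L)))   ∎))
    where
    open ≡-Reasoning
    reassociate : ∀ a b c → a *ℤ b *ℤ c ≡ b *ℤ (a *ℤ c)
    reassociate a b c = solveℤ (a ∷ b ∷ c ∷ [])
  Y≢0 : ∀ {Y} → n *ℤ Y ≡ + p *ℤ + q′ - + p′ *ℤ + q → Y ≢ 0ℤ
  Y≢0 {Y} nY≡ refl = <⇒≢ p<p′ (*-cancelʳ-≡ p p′ q {{>-nonZero 0<q}} (begin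
    p * q      ≡⟨ cong (p *_) q≡q′ ⟩
    p * q′     ≡⟨ pq′≡p′q ⟩
    p′ * q     ∎))
    where
    open ≡-Reasoning
    pq′≡p′q-ℤ : + p *ℤ + q′ ≡ + p′ *ℤ + q
    pq′≡p′q-ℤ = ℤₚ.i-j≡0⇒i≡j _ _ (trans (sym nY≡) (ℤₚ.*-zeroʳ n))
    pq′≡p′q : p * q′ ≡ p′ * q
    pq′≡p′q = ℤₚ.+-injective (trans (ℤₚ.pos-* p q′) (trans pq′≡p′q-ℤ (sym (ℤₚ.pos-* p′ q))))
    q≡q′ : q ≡ q′
    q≡q′ = m*m≡n*n⇒m≡n (ℤₚ.+-injective (trans (ℤₚ.pos-* q q)
             (trans (equal-norms⇒equal-squares (+ A) (+ p) (+ q) (+ p′) (+ q′) n N≡n N′≡n pq′≡p′q-ℤ) (sym (ℤₚ.pos-* q′ q′)))))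

∣∓d∣≡d : ∀ {n d} → n ≡ - + d ⊎ n ≡ + d → ∣ n ∣ ≡ d
∣∓d∣≡d (inj₁ refl) = ℤₚ.∣-i∣≡∣i∣ (+ _)
∣∓d∣≡d (inj₂ refl) = refl

∓-index : ∀ {n d} → n ≡ - + d ⊎ n ≡ + d → Fin 2
∓-index (inj₁ _) = Fin.zero
∓-index (inj₂ _) = Fin.suc Fin.zero

∓-index-injective : ∀ {n n′ d d′} (s : n ≡ - + d ⊎ n ≡ + d) (s′ : n′ ≡ - + d′ ⊎ n′ ≡ + d′) →
                    d ≡ d′ → ∓-index s ≡ ∓-index s′ → n ≡ n′
∓-index-injective (inj₁ refl) (inj₁ refl) refl _ = refl
∓-index-injective (inj₂ refl) (inj₂ refl) refl _ = refl
∓-index-injective (inj₁ _) (inj₂ _) _ ()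
∓-index-injective (inj₂ _) (inj₁ _) _ ()

norm-code : ∀ {A K} → BoundedNormPair A K → Fin (2 * suc K)
norm-code P = combine (∓-index norm≡∓d) (fromℕ< (s≤s d≤K))
  where open BoundedNormPair P

-- Pairs with equal codes have equal norms and are congruent modulo K!, a multiple of that norm.
pair-code : ∀ {A K} → BoundedNormPair A K → Fin (2 * suc K * K ! * K !)
pair-code {K = K} P = combine (combine (norm-code P) (p mod K !)) (q mod K !)
  where
  open BoundedNormPair P
  instance _ = K !≢0

same-code⇒pell-solution : ∀ {A K} (P P′ : BoundedNormPair A K) → pair-code P ≡ pair-code P′ →
                          BoundedNormPair.p P < BoundedNormPair.p P′ → ∃ (IsPellSolution A)
same-code⇒pell-solution {A} {K} P P′ same-code p<p′ =
  let same-code′ , same-q = Finₚ.combine-injective (combine (norm-code P) (p mod K !)) (q mod K !)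
                                                   (combine (norm-code P′) (p′ mod K !)) (q′ mod K !) same-code
      same-norm-code , same-p = Finₚ.combine-injective (norm-code P) (p mod K !) (norm-code P′) (p′ mod K !) same-code′
      same-index , same-d = Finₚ.combine-injective (∓-index norm≡∓d) (fromℕ< (s≤s d≤K))
                                                   (∓-index norm′≡∓d′) (fromℕ< (s≤s d′≤K)) same-norm-code
      N′≡N = ∓-index-injective norm′≡∓d′ norm≡∓d (Finₚ.fromℕ<-injective _ _ _ _ (sym same-d)) (sym same-index)
  in pell-from-congruent-pairs {A} {p} {q} {p′} {q′} (ℤ∣.∣ᵤ⇒∣ (subst (_∣ K !) (sym (∣∓d∣≡d norm≡∓d)) (∣n! 0<d d≤K)))
       refl N′≡N (Finₚ.fromℕ<-injective _ _ _ _ same-p) (Finₚ.fromℕ<-injective _ _ _ _ same-q) 0<q p<p′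
  where
  open BoundedNormPair P
  open BoundedNormPair P′ using () renaming (p to p′; q to q′; d≤K to d′≤K; norm≡∓d to norm′≡∓d′)
  instance
    _ = K !≢0
    n≢0 : ℤ.NonZero (norm (+ A) (+ p) (+ q))
    n≢0 = subst NonZero (sym (∣∓d∣≡d norm≡∓d)) (>-nonZero 0<d)

pell-solvable : ∀ A → IrrationalSqrt A → ∃ (IsPellSolution A)
pell-solvable A irr = from-collision (Finₚ.pigeonhole (n<1+n _) (pair-code ∘ pairs ∘ toℕ))
  where
  pairs = bounded-norm-pairs A irr
  from-collision : (∃₂ λ i j → i Fin.< j × pair-code (pairs (toℕ i)) ≡ pair-code (pairs (toℕ j))) → ∃ (IsPellSolution A)
  from-collision (i , j , i<j , same-code) =
    same-code⇒pell-solution (pairs (toℕ i)) (pairs (toℕ j)) same-code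
      (step-increasing⇒increasing (BoundedNormPair.p ∘ pairs) (bounded-norm-pairs-increasing A irr) i<j)

pell-solution? : ∀ A x → Dec (IsPellSolution A x)
pell-solution? A x with 0 <? x | anyUpTo? (λ y → (0 <? y) ×-dec (y * y ≟ A * (x * x) + 1)) (suc (A * (x * x) + 1))
... | no x≯0 | _ = no (x≯0 ∘ proj₁)
... | yes 0<x | yes (y , _ , solution) = yes (0<x , y , solution)
... | yes 0<x | no none = no λ (_ , y , 0<y , y²≡M) →
  none (y , s≤s (≤-trans (m≤m*n y y {{>-nonZero 0<y}}) (≤-reflexive y²≡M)) , 0<y , y²≡M)

minimal-pell-solution : ∀ A → IrrationalSqrt A → ∃ (IsMinimalPellSolution A)
minimal-pell-solution A irr = least-witness (pell-solution? A) (proj₂ (pell-solvable A irr))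


-- The minimal solution for a prime A ≡ 1 (mod 4)

pell-solution-halved : ∀ {A c x y} → A ≡ 1 + 4 * c → y * y ≡ A * (x * x) + 1 →
                       ∃₂ λ t w → x ≡ 2 * t × w * suc w ≡ A * (t * t)
pell-solution-halved {c = c} {x} {y} refl y²≡Ax²+1 with even⊎odd x | even⊎odd y
... | inj₂ (k , refl) | _ =
  ⊥-elim (square≢2+4* y (k + k * k + c * ((1 + 2 * k) * (1 + 2 * k))) (trans y²≡Ax²+1 (solve (c ∷ k ∷ []))))
... | inj₁ (t , refl) | inj₁ (w , refl) = ⊥-elim (even≢odd (2 * (w * w)) (2 * ((1 + 4 * c) * (t * t))) (begin
  2 * (2 * (w * w))                     ≡⟨ solve (w ∷ []) ⟩
  2 * w * (2 * w)                       ≡⟨ y²≡Ax²+1 ⟩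
  (1 + 4 * c) * (2 * t * (2 * t)) + 1   ≡⟨ solve (c ∷ t ∷ []) ⟩
  suc (2 * (2 * ((1 + 4 * c) * (t * t)))) ∎))
  where open ≡-Reasoning
... | inj₁ (t , refl) | inj₂ (w , refl) = t , w , refl , *-cancelˡ-≡ _ _ 4 (suc-injective (begin
  suc (4 * (w * suc w))               ≡⟨ solve (w ∷ []) ⟩
  (1 + 2 * w) * (1 + 2 * w)           ≡⟨ y²≡Ax²+1 ⟩
  (1 + 4 * c) * (2 * t * (2 * t)) + 1 ≡⟨ solve (c ∷ t ∷ []) ⟩
  suc (4 * ((1 + 4 * c) * (t * t)))   ∎))
  where open ≡-Reasoning

consecutive-product-A∣w : ∀ {A t w w′} .{{_ : NonZero A}} → w ≡ w′ * A → w * suc w ≡ A * (t * t) →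
                          ∃₂ λ r s → s * s ≡ A * (r * r) + 1 × t ≡ r * s
consecutive-product-A∣w {A} {t} {w} {w′} w≡w′A w[w+1]≡At² =
  let r , s , w′≡r² , w+1≡s² , t≡rs = coprime-square-factors w′⊥w+1 w′[w+1]≡t²
  in r , s , (begin
    s * s              ≡⟨ w+1≡s² ⟨
    suc w              ≡⟨ cong suc w≡w′A ⟩
    suc (w′ * A)       ≡⟨ cong (λ w′ → suc (w′ * A)) w′≡r² ⟩
    suc (r * r * A)    ≡⟨ cong suc (*-comm (r * r) A) ⟩
    suc (A * (r * r))  ≡⟨ +-comm 1 (A * (r * r)) ⟩
    A * (r * r) + 1    ∎) , t≡rs
  where
  open ≡-Reasoning
  w′⊥w+1 : Coprime w′ (suc w)
  w′⊥w+1 = coprime-of-divisor (divides A (trans w≡w′A (*-comm w′ A))) (consecutive-coprime w)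
  w′[w+1]≡t² : w′ * suc w ≡ t * t
  w′[w+1]≡t² = *-cancelˡ-≡ (w′ * suc w) (t * t) A (begin
    A * (w′ * suc w)   ≡⟨ *-assoc A w′ (suc w) ⟨
    A * w′ * suc w     ≡⟨ cong (_* suc w) (trans (*-comm A w′) (sym w≡w′A)) ⟩
    w * suc w          ≡⟨ w[w+1]≡At² ⟩
    A * (t * t)        ∎)

consecutive-product-A∣1+w : ∀ {A t w w′} .{{_ : NonZero A}} → suc w ≡ w′ * A → w * suc w ≡ A * (t * t) →
                            ∃₂ λ r s → s * s + 1 ≡ A * (r * r) × t ≡ s * r
consecutive-product-A∣1+w {A} {t} {w} {w′} w+1≡w′A w[w+1]≡At² =
  let s , r , w≡s² , w′≡r² , t≡sr = coprime-square-factors w⊥w′ w[w′]≡t²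
  in r , s , (begin
    s * s + 1          ≡⟨ cong (_+ 1) w≡s² ⟨
    w + 1              ≡⟨ +-comm w 1 ⟩
    suc w              ≡⟨ w+1≡w′A ⟩
    w′ * A             ≡⟨ cong (_* A) w′≡r² ⟩
    r * r * A          ≡⟨ *-comm (r * r) A ⟩
    A * (r * r)        ∎) , t≡sr
  where
  open ≡-Reasoning
  w⊥w′ : Coprime w w′
  w⊥w′ = coprime-sym (coprime-of-divisor (divides A (trans w+1≡w′A (*-comm w′ A))) (coprime-sym (consecutive-coprime w)))
  w[w′]≡t² : w * w′ ≡ t * t
  w[w′]≡t² = *-cancelˡ-≡ (w * w′) (t * t) A (begin
    A * (w * w′)       ≡⟨ solve (A ∷ w ∷ w′ ∷ []) ⟩
    w * (A * w′)       ≡⟨ cong (w *_) (trans (*-comm A w′) (sym w+1≡w′A)) ⟩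
    w * suc w          ≡⟨ w[w+1]≡At² ⟩
    A * (t * t)        ∎)

consecutive-product-factors : ∀ {A t w} → Prime A → w * suc w ≡ A * (t * t) →
  (∃₂ λ r s → s * s ≡ A * (r * r) + 1 × t ≡ r * s) ⊎ (∃₂ λ r s → s * s + 1 ≡ A * (r * r) × t ≡ s * r)
consecutive-product-factors {A} {t} {w} pA w[w+1]≡At²
  with euclidsLemma w (suc w) pA (divides (t * t) (trans w[w+1]≡At² (*-comm A (t * t))))
... | inj₁ (divides w′ w≡w′A)   = inj₁ (consecutive-product-A∣w {w′ = w′} {{prime⇒nonZero pA}} w≡w′A w[w+1]≡At²)
... | inj₂ (divides w′ w+1≡w′A) = inj₂ (consecutive-product-A∣1+w {w′ = w′} {{prime⇒nonZero pA}} w+1≡w′A w[w+1]≡At²)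

minimal-pell-solution-via-negative-pell : ∀ {A x} → Prime A → A % 4 ≡ 1 → IsMinimalPellSolution A x →
                                ∃₂ λ r s → s * s + 1 ≡ A * (r * r) × x ≡ 2 * s * r
minimal-pell-solution-via-negative-pell {A} {x} pA A%4≡1 ((0<x , y , _ , y²≡Ax²+1) , minimal)
  with pell-solution-halved {A} {A / 4} {x} {y} (m%n≡r⇒m≡r+n*[m/n] {A} {4} A%4≡1) y²≡Ax²+1
... | t , w , refl , w[w+1]≡At² with consecutive-product-factors {t = t} {w} pA w[w+1]≡At²
... | inj₂ (r , s , s²+1≡Ar² , refl) = r , s , s²+1≡Ar² , sym (*-assoc 2 s r)
... | inj₁ (zero , s , _ , refl) = ⊥-elim (<-irrefl refl 0<x)
... | inj₁ (r@(suc _) , s , s²≡Ar²+1 , refl) = ⊥-elim (<⇒≱ r<2rs (minimal r (pell-solution {A} {r} {s} z<s s²≡Ar²+1)))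
  where
  r<2rs : r < 2 * (r * s)
  r<2rs = <-≤-trans (m<m*n r 2 (s≤s (s≤s z≤n)))
                    (≤-trans (≤-reflexive (*-comm r 2)) (*-monoʳ-≤ 2 (m≤m*n r s {{>-nonZero (n*n≡m+1⇒0<n s²≡Ar²+1)}})))


-- Gaussian integers and Pythagorean triples

IsUnit : ℤ → Set
IsUnit ε = ε ≡ 1ℤ ⊎ ε ≡ - 1ℤ

unit*unit≡1 : ∀ {ε} → IsUnit ε → ε *ℤ ε ≡ 1ℤ
unit*unit≡1 (inj₁ refl) = refl
unit*unit≡1 (inj₂ refl) = refl

unit-*-unit : ∀ {σ ε} → IsUnit σ → IsUnit ε → IsUnit (σ *ℤ ε)
unit-*-unit (inj₁ refl) (inj₁ refl) = inj₁ refl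
unit-*-unit (inj₁ refl) (inj₂ refl) = inj₂ refl
unit-*-unit (inj₂ refl) (inj₁ refl) = inj₂ refl
unit-*-unit (inj₂ refl) (inj₂ refl) = inj₁ refl

neg-unit : ∀ {σ} → IsUnit σ → IsUnit (- σ)
neg-unit (inj₁ refl) = inj₂ refl
neg-unit (inj₂ refl) = inj₁ refl

∣unit*x∣≡∣x∣ : ∀ {σ} x → IsUnit σ → ∣ σ *ℤ x ∣ ≡ ∣ x ∣
∣unit*x∣≡∣x∣ x (inj₁ refl) = cong ∣_∣ (ℤₚ.*-identityˡ x)
∣unit*x∣≡∣x∣ x (inj₂ refl) = trans (cong ∣_∣ (ℤₚ.-1*i≡-i x)) (ℤₚ.∣-i∣≡∣i∣ x)

divisor-of-unit≡1 : ∀ {k ε} → IsUnit ε → + k ℤ∣.∣ ε → k ≡ 1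
divisor-of-unit≡1 (inj₁ refl) k∣ε = ∣1⇒≡1 (ℤ∣.∣⇒∣ᵤ k∣ε)
divisor-of-unit≡1 (inj₂ refl) k∣ε = ∣1⇒≡1 (ℤ∣.∣⇒∣ᵤ k∣ε)

sign-decomposition : ∀ z → ∃ λ σ → IsUnit σ × z ≡ σ *ℤ + ∣ z ∣
sign-decomposition (+ n)     = 1ℤ , inj₁ refl , sym (ℤₚ.*-identityˡ (+ n))
sign-decomposition ℤ.-[1+ n ] = - 1ℤ , inj₂ refl , sym (ℤₚ.-1*i≡-i (+ suc n))

units-equal-or-opposite : ∀ {σ τ} → IsUnit σ → IsUnit τ → τ ≡ σ ⊎ τ ≡ - σ
units-equal-or-opposite (inj₁ refl) (inj₁ refl) = inj₁ refl
units-equal-or-opposite (inj₁ refl) (inj₂ refl) = inj₂ refl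
units-equal-or-opposite (inj₂ refl) (inj₁ refl) = inj₂ refl
units-equal-or-opposite (inj₂ refl) (inj₂ refl) = inj₁ refl

common-divisor-of-unit : ∀ {k a b c d ε} → IsUnit ε → c *ℤ b +ℤ d *ℤ a ≡ ε →
                         + k ℤ∣.∣ c → + k ℤ∣.∣ d *ℤ a → k ≡ 1
common-divisor-of-unit {b = b} ε-unit cb+da≡ε k∣c k∣da =
  divisor-of-unit≡1 ε-unit (subst (_ ℤ∣.∣_) cb+da≡ε (ℤ∣.∣m∣n⇒∣m+n (ℤ∣.∣m⇒∣m*n b k∣c) k∣da))

prime-divides-sa±b : ∀ {A} {a b s r : ℤ} → Prime A → + A ≡ a *ℤ a +ℤ b *ℤ b → s *ℤ s +ℤ 1ℤ ≡ + A *ℤ (r *ℤ r) →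
                     ∃₂ λ ε c → IsUnit ε × + A *ℤ c ≡ s *ℤ a +ℤ ε *ℤ b
prime-divides-sa±b {A} {a} {b} {s} {r} pA A≡a²+b² s²+1≡Ar² =
  choose-sign (euclidsLemma ∣ s *ℤ a +ℤ b ∣ ∣ s *ℤ a - b ∣ pA A∣product)
  where
  open ≡-Reasoning
  regroup : ∀ a r n → a *ℤ a *ℤ (n *ℤ (r *ℤ r)) - n ≡ (a *ℤ a *ℤ (r *ℤ r) - 1ℤ) *ℤ n
  regroup a r n = solveℤ (a ∷ r ∷ n ∷ [])
  product≡ : (s *ℤ a +ℤ b) *ℤ (s *ℤ a - b) ≡ (a *ℤ a *ℤ (r *ℤ r) - 1ℤ) *ℤ + A
  product≡ = begin
    (s *ℤ a +ℤ b) *ℤ (s *ℤ a - b)                    ≡⟨ solveℤ (s ∷ a ∷ b ∷ []) ⟩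
    a *ℤ a *ℤ (s *ℤ s +ℤ 1ℤ) - (a *ℤ a +ℤ b *ℤ b)    ≡⟨ cong₂ (λ x y → a *ℤ a *ℤ x - y) s²+1≡Ar² (sym A≡a²+b²) ⟩
    a *ℤ a *ℤ (+ A *ℤ (r *ℤ r)) - + A                ≡⟨ regroup a r (+ A) ⟩
    (a *ℤ a *ℤ (r *ℤ r) - 1ℤ) *ℤ + A                 ∎
  A∣product : A ∣ ∣ s *ℤ a +ℤ b ∣ * ∣ s *ℤ a - b ∣
  A∣product = subst (A ∣_) (ℤₚ.abs-* (s *ℤ a +ℤ b) (s *ℤ a - b)) (ℤ∣.∣⇒∣ᵤ {+ A} (ℤ∣.divides (a *ℤ a *ℤ (r *ℤ r) - 1ℤ) product≡))
  choose-sign : (A ∣ ∣ s *ℤ a +ℤ b ∣) ⊎ (A ∣ ∣ s *ℤ a - b ∣) → ∃₂ λ ε c → IsUnit ε × + A *ℤ c ≡ s *ℤ a +ℤ ε *ℤ b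
  choose-sign (inj₁ A∣sa+b) =
    let ℤ∣.divides c sa+b≡cA = ℤ∣.∣ᵤ⇒∣ {+ A} A∣sa+b
    in 1ℤ , c , inj₁ refl , trans (ℤₚ.*-comm (+ A) c) (trans (sym sa+b≡cA) (cong (s *ℤ a +ℤ_) (sym (ℤₚ.*-identityˡ b))))
  choose-sign (inj₂ A∣sa-b) =
    let ℤ∣.divides c sa-b≡cA = ℤ∣.∣ᵤ⇒∣ {+ A} A∣sa-b
    in - 1ℤ , c , inj₂ refl , trans (ℤₚ.*-comm (+ A) c) (trans (sym sa-b≡cA) (cong (s *ℤ a +ℤ_) (sym (ℤₚ.-1*i≡-i b))))

-- With A c = s a + ε b and A d = ε a − s b, c + di = (s + εi)(a − bi)/A = (s + εi)/(a + bi).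
gaussian-conjugate-quotient : ∀ A a b s r ε c → s *ℤ s +ℤ 1ℤ ≡ A *ℤ (r *ℤ r) → ε *ℤ ε ≡ 1ℤ →
  A *ℤ c ≡ s *ℤ a +ℤ ε *ℤ b → ∃ λ d → A *ℤ d ≡ ε *ℤ a - s *ℤ b
gaussian-conjugate-quotient A a b s r ε c s²+1≡Ar² ε²≡1 Ac≡sa+εb = ε *ℤ (r *ℤ r *ℤ a - s *ℤ c) , (begin
  A *ℤ (ε *ℤ (r *ℤ r *ℤ a - s *ℤ c))                   ≡⟨ solveℤ (A ∷ ε ∷ r ∷ a ∷ s ∷ c ∷ []) ⟩
  ε *ℤ (A *ℤ (r *ℤ r) *ℤ a - s *ℤ (A *ℤ c))            ≡⟨ cong₂ (λ x y → ε *ℤ (x *ℤ a - s *ℤ y)) (sym s²+1≡Ar²) Ac≡sa+εb ⟩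
  ε *ℤ ((s *ℤ s +ℤ 1ℤ) *ℤ a - s *ℤ (s *ℤ a +ℤ ε *ℤ b)) ≡⟨ solveℤ (ε ∷ s ∷ a ∷ b ∷ []) ⟩
  ε *ℤ a - ε *ℤ ε *ℤ (s *ℤ b)                          ≡⟨ cong (λ x → ε *ℤ a - x *ℤ (s *ℤ b)) ε²≡1 ⟩
  ε *ℤ a - 1ℤ *ℤ (s *ℤ b)                              ≡⟨ cong (λ x → ε *ℤ a - x) (ℤₚ.*-identityˡ (s *ℤ b)) ⟩
  ε *ℤ a - s *ℤ b                                      ∎)
  where open ≡-Reasoning

gaussian-quotient-relations : ∀ A a b s r ε c d .{{_ : ℤ.NonZero A}} → A ≡ a *ℤ a +ℤ b *ℤ b → s *ℤ s +ℤ 1ℤ ≡ A *ℤ (r *ℤ r) →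
  ε *ℤ ε ≡ 1ℤ → A *ℤ c ≡ s *ℤ a +ℤ ε *ℤ b → A *ℤ d ≡ ε *ℤ a - s *ℤ b →
  c *ℤ c +ℤ d *ℤ d ≡ r *ℤ r × c *ℤ b +ℤ d *ℤ a ≡ ε × c *ℤ a - d *ℤ b ≡ s
gaussian-quotient-relations A a b s r ε c d A≡a²+b² s²+1≡Ar² ε²≡1 Ac≡sa+εb Ad≡εa-sb = c²+d²≡r² , cb+da≡ε , ca-db≡s
  where
  open ≡-Reasoning
  c²+d²≡r² : c *ℤ c +ℤ d *ℤ d ≡ r *ℤ r
  c²+d²≡r² = ℤₚ.*-cancelˡ-≡ (A *ℤ A) _ _ {{ℤₚ.i*j≢0 A A}} (begin
    A *ℤ A *ℤ (c *ℤ c +ℤ d *ℤ d)                        ≡⟨ solveℤ (A ∷ c ∷ d ∷ []) ⟩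
    (A *ℤ c) *ℤ (A *ℤ c) +ℤ (A *ℤ d) *ℤ (A *ℤ d)        ≡⟨ cong₂ (λ x y → x *ℤ x +ℤ y *ℤ y) Ac≡sa+εb Ad≡εa-sb ⟩
    (s *ℤ a +ℤ ε *ℤ b) *ℤ (s *ℤ a +ℤ ε *ℤ b) +ℤ (ε *ℤ a - s *ℤ b) *ℤ (ε *ℤ a - s *ℤ b)
                                                       ≡⟨ solveℤ (s ∷ a ∷ ε ∷ b ∷ []) ⟩
    (s *ℤ s +ℤ ε *ℤ ε) *ℤ (a *ℤ a +ℤ b *ℤ b)            ≡⟨ cong₂ (λ x y → (s *ℤ s +ℤ x) *ℤ y) ε²≡1 (sym A≡a²+b²) ⟩
    (s *ℤ s +ℤ 1ℤ) *ℤ A                                ≡⟨ cong (_*ℤ A) s²+1≡Ar² ⟩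
    A *ℤ (r *ℤ r) *ℤ A                                 ≡⟨ solveℤ (A ∷ r ∷ []) ⟩
    A *ℤ A *ℤ (r *ℤ r)                                 ∎)
  cb+da≡ε : c *ℤ b +ℤ d *ℤ a ≡ ε
  cb+da≡ε = ℤₚ.*-cancelˡ-≡ A _ _ (begin
    A *ℤ (c *ℤ b +ℤ d *ℤ a)                            ≡⟨ solveℤ (A ∷ c ∷ b ∷ d ∷ a ∷ []) ⟩
    (A *ℤ c) *ℤ b +ℤ (A *ℤ d) *ℤ a                      ≡⟨ cong₂ (λ x y → x *ℤ b +ℤ y *ℤ a) Ac≡sa+εb Ad≡εa-sb ⟩
    (s *ℤ a +ℤ ε *ℤ b) *ℤ b +ℤ (ε *ℤ a - s *ℤ b) *ℤ a    ≡⟨ solveℤ (s ∷ a ∷ ε ∷ b ∷ []) ⟩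
    (a *ℤ a +ℤ b *ℤ b) *ℤ ε                             ≡⟨ cong (_*ℤ ε) A≡a²+b² ⟨
    A *ℤ ε                                             ∎)
  ca-db≡s : c *ℤ a - d *ℤ b ≡ s
  ca-db≡s = ℤₚ.*-cancelˡ-≡ A _ _ (begin
    A *ℤ (c *ℤ a - d *ℤ b)                             ≡⟨ solveℤ (A ∷ c ∷ b ∷ d ∷ a ∷ []) ⟩
    (A *ℤ c) *ℤ a - (A *ℤ d) *ℤ b                       ≡⟨ cong₂ (λ x y → x *ℤ a - y *ℤ b) Ac≡sa+εb Ad≡εa-sb ⟩
    (s *ℤ a +ℤ ε *ℤ b) *ℤ a - (ε *ℤ a - s *ℤ b) *ℤ b     ≡⟨ solveℤ (s ∷ a ∷ ε ∷ b ∷ []) ⟩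
    (a *ℤ a +ℤ b *ℤ b) *ℤ s                             ≡⟨ cong (_*ℤ s) A≡a²+b² ⟨
    A *ℤ s                                             ∎)

gaussian-decomposition : ∀ {A a b s r} → Prime A → A ≡ a * a + b * b → s * s + 1 ≡ A * (r * r) →
  ∃ λ ε → ∃₂ λ c d → IsUnit ε × c *ℤ c +ℤ d *ℤ d ≡ + r *ℤ + r × c *ℤ + b +ℤ d *ℤ + a ≡ ε × c *ℤ + a - d *ℤ + b ≡ + s
gaussian-decomposition {A} {a} {b} {s} {r} pA A≡a²+b² s²+1≡Ar² =
  let ε , c , ε-unit , Ac≡sa+εb = prime-divides-sa±b {A} {+ a} {+ b} {+ s} {+ r} pA A≡a²+b²ℤ s²+1≡Ar²ℤ
      d , Ad≡εa-sb = gaussian-conjugate-quotient (+ A) (+ a) (+ b) (+ s) (+ r) ε c s²+1≡Ar²ℤ (unit*unit≡1 ε-unit) Ac≡sa+εb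
  in ε , c , d , ε-unit , gaussian-quotient-relations (+ A) (+ a) (+ b) (+ s) (+ r) ε c d {{prime⇒nonZero pA}}
                            A≡a²+b²ℤ s²+1≡Ar²ℤ (unit*unit≡1 ε-unit) Ac≡sa+εb Ad≡εa-sb
  where
  A≡a²+b²ℤ : + A ≡ + a *ℤ + a +ℤ + b *ℤ + b
  A≡a²+b²ℤ = trans (cong +_ A≡a²+b²) (trans (ℤₚ.pos-+ (a * a) (b * b)) (cong₂ _+ℤ_ (ℤₚ.pos-* a a) (ℤₚ.pos-* b b)))
  s²+1≡Ar²ℤ : + s *ℤ + s +ℤ 1ℤ ≡ + A *ℤ (+ r *ℤ + r)
  s²+1≡Ar²ℤ = begin
    + s *ℤ + s +ℤ 1ℤ      ≡⟨ cong (_+ℤ 1ℤ) (ℤₚ.pos-* s s) ⟨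
    + (s * s) +ℤ 1ℤ       ≡⟨ ℤₚ.pos-+ (s * s) 1 ⟨
    + (s * s + 1)         ≡⟨ cong +_ s²+1≡Ar² ⟩
    + (A * (r * r))       ≡⟨ ℤₚ.pos-* A (r * r) ⟩
    + A *ℤ + (r * r)      ≡⟨ cong (λ x → + A *ℤ x) (ℤₚ.pos-* r r) ⟩
    + A *ℤ (+ r *ℤ + r)   ∎
    where open ≡-Reasoning

even-leg-of-sum-of-squares : ∀ {a b c j} → a * a + b * b ≡ 1 + 4 * c → b ≡ 1 + 2 * j → ∃ λ α → a ≡ 2 * α
even-leg-of-sum-of-squares {a} {b} {c} {j} a²+b²≡1+4c refl with even⊎odd a
... | inj₁ a-even = a-even
... | inj₂ (k , refl) = ⊥-elim (even≢odd (1 + 2 * (k * k + k + j * j + j)) (2 * c) (begin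
  2 * (1 + 2 * (k * k + k + j * j + j))         ≡⟨ solve (k ∷ j ∷ []) ⟩
  (1 + 2 * k) * (1 + 2 * k) + (1 + 2 * j) * (1 + 2 * j) ≡⟨ a²+b²≡1+4c ⟩
  1 + 4 * c                                     ≡⟨ solve (c ∷ []) ⟩
  suc (2 * (2 * c))                             ∎))
  where open ≡-Reasoning

odd²+square≡square⇒even : ∀ {C D r k} → C * C + D * D ≡ r * r → C ≡ 1 + 2 * k → ∃ λ D′ → D ≡ 2 * D′
odd²+square≡square⇒even {C} {D} {r} {k} C²+D²≡r² refl with even⊎odd D
... | inj₁ D-even = D-even
... | inj₂ (j , refl) = ⊥-elim (square≢2+4* r (k * k + k + j * j + j) (begin
  r * r                                                 ≡⟨ C²+D²≡r² ⟨
  (1 + 2 * k) * (1 + 2 * k) + (1 + 2 * j) * (1 + 2 * j) ≡⟨ solve (k ∷ j ∷ []) ⟩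
  2 + 4 * (k * k + k + j * j + j)                       ∎))
  where open ≡-Reasoning

pythagorean-parametrisation : ∀ {C D r} → Coprime C D → C * C + 2 * D * (2 * D) ≡ r * r →
                              ∃₂ λ l m → C + m * m ≡ l * l × D ≡ l * m × r ≡ l * l + m * m
pythagorean-parametrisation {C} {D} {r} C⊥D C²+[2D]²≡r²
  with m≤n⇒∃[o]m+o≡n {C} {r} (m*m≤n*n⇒m≤n (≤-trans (m≤m+n (C * C) _) (≤-reflexive C²+[2D]²≡r²)))
... | δ , refl with even⊎odd δ
... | inj₂ (k , refl) = ⊥-elim (even≢odd (2 * (D * D)) (C + 2 * k + 2 * (k * C) + 2 * (k * k)) (begin
  2 * (2 * (D * D))                         ≡⟨ solve (D ∷ []) ⟩
  2 * D * (2 * D)                           ≡⟨ [2D]²≡δ[2C+δ] ⟩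
  (1 + 2 * k) * (2 * C + (1 + 2 * k))       ≡⟨ solve (k ∷ C ∷ []) ⟩
  suc (2 * (C + 2 * k + 2 * (k * C) + 2 * (k * k))) ∎))
  where
  open ≡-Reasoning
  [2D]²≡δ[2C+δ] : 2 * D * (2 * D) ≡ (1 + 2 * k) * (2 * C + (1 + 2 * k))
  [2D]²≡δ[2C+δ] = +-cancelˡ-≡ (C * C) _ _ (trans C²+[2D]²≡r² (solve (C ∷ k ∷ [])))
... | inj₁ (e , refl) =
  let m , l , e≡m² , C+e≡l² , D≡ml = coprime-square-factors e⊥C+e (sym D²≡e[C+e])
  in l , m , trans (cong (λ x → C + x) (sym e≡m²)) C+e≡l² , trans D≡ml (*-comm m l) , (begin
    C + 2 * e            ≡⟨ solve (C ∷ e ∷ []) ⟩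
    (C + e) + e          ≡⟨ cong₂ _+_ C+e≡l² e≡m² ⟩
    l * l + m * m        ∎)
  where
  open ≡-Reasoning
  D²≡e[C+e] : D * D ≡ e * (C + e)
  D²≡e[C+e] = *-cancelˡ-≡ (D * D) (e * (C + e)) 4 (+-cancelˡ-≡ (C * C) _ _ (begin
    C * C + 4 * (D * D)              ≡⟨ solve (C ∷ D ∷ []) ⟩
    C * C + 2 * D * (2 * D)          ≡⟨ C²+[2D]²≡r² ⟩
    (C + 2 * e) * (C + 2 * e)        ≡⟨ solve (C ∷ e ∷ []) ⟩
    C * C + 4 * (e * (C + e))        ∎))
  e⊥C+e : Coprime e (C + e)
  e⊥C+e {g} (g∣e , g∣C+e) = C⊥D (g∣C , coprime-divisor g⊥D g∣D²)
    where
    g∣C : g ∣ C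
    g∣C = ∣m+n∣m⇒∣n (subst (g ∣_) (+-comm C e) g∣C+e) g∣e
    g⊥D : Coprime g D
    g⊥D = coprime-of-divisor g∣C C⊥D
    g∣D² : g ∣ D * D
    g∣D² = subst (g ∣_) (sym D²≡e[C+e]) (∣-trans g∣e (m∣m*n (C + e)))

signed-legs : ∀ {c d : ℤ} {l m : ℕ} → + ∣ c ∣ ≡ + l *ℤ + l - + m *ℤ + m → + ∣ d ∣ ≡ + 2 *ℤ + l *ℤ + m →
  ∃ λ σ → ∃₂ λ l′ m′ → IsUnit σ × l′ * l′ + m′ * m′ ≡ l * l + m * m
    × c ≡ σ *ℤ (+ l′ *ℤ + l′ - + m′ *ℤ + m′) × d ≡ - (σ *ℤ (+ 2 *ℤ + l′ *ℤ + m′))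
signed-legs {c} {d} {l} {m} ∣c∣≡l²-m² ∣d∣≡2lm
  with σ , σ-unit , c≡σ∣c∣ ← sign-decomposition c
  with τ , τ-unit , d≡τ∣d∣ ← sign-decomposition d
  with units-equal-or-opposite σ-unit τ-unit
... | inj₂ refl = σ , l , m , σ-unit , refl , trans c≡σ∣c∣ (cong (σ *ℤ_) ∣c∣≡l²-m²) ,
                  trans d≡τ∣d∣ (trans (cong (- σ *ℤ_) ∣d∣≡2lm) (sym (ℤₚ.neg-distribˡ-* σ (+ 2 *ℤ + l *ℤ + m))))
... | inj₁ refl = - σ , m , l , neg-unit σ-unit , +-comm (m * m) (l * l) ,
                  trans c≡σ∣c∣ (trans (cong (σ *ℤ_) ∣c∣≡l²-m²) (swap-squares σ (+ l) (+ m))) ,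
                  trans d≡τ∣d∣ (trans (cong (σ *ℤ_) ∣d∣≡2lm) (swap-product σ (+ l) (+ m)))
  where
  swap-squares : ∀ σ x y → σ *ℤ (x *ℤ x - y *ℤ y) ≡ - σ *ℤ (y *ℤ y - x *ℤ x)
  swap-squares σ x y = solveℤ (σ ∷ x ∷ y ∷ [])
  swap-product : ∀ σ x y → σ *ℤ (+ 2 *ℤ x *ℤ y) ≡ - (- σ *ℤ (+ 2 *ℤ y *ℤ x))
  swap-product σ x y = solveℤ (σ ∷ x ∷ y ∷ [])

∣∣-sum-of-squares : ∀ {c d : ℤ} {r} → c *ℤ c +ℤ d *ℤ d ≡ + r *ℤ + r → ∣ c ∣ * ∣ c ∣ + ∣ d ∣ * ∣ d ∣ ≡ r * r
∣∣-sum-of-squares {c} {d} {r} c²+d²≡r² = ℤₚ.+-injective (begin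
  + (∣ c ∣ * ∣ c ∣ + ∣ d ∣ * ∣ d ∣)        ≡⟨ ℤₚ.pos-+ (∣ c ∣ * ∣ c ∣) (∣ d ∣ * ∣ d ∣) ⟩
  + (∣ c ∣ * ∣ c ∣) +ℤ + (∣ d ∣ * ∣ d ∣)    ≡⟨ cong₂ _+ℤ_ (square-∣∣ c) (square-∣∣ d) ⟨
  c *ℤ c +ℤ d *ℤ d                        ≡⟨ c²+d²≡r² ⟩
  + r *ℤ + r                              ≡⟨ ℤₚ.pos-* r r ⟨
  + (r * r)                               ∎)
  where open ≡-Reasoning

+-difference-of-squares : ∀ {n l m} → n + m * m ≡ l * l → + n ≡ + l *ℤ + l - + m *ℤ + m
+-difference-of-squares {n} {l} {m} n+m²≡l² = begin
  + n                                 ≡⟨ x≡x+y-y (+ n) (+ (m * m)) ⟩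
  + n +ℤ + (m * m) - + (m * m)        ≡⟨ cong (_- + (m * m)) (ℤₚ.pos-+ n (m * m)) ⟨
  + (n + m * m) - + (m * m)           ≡⟨ cong (λ x → + x - + (m * m)) n+m²≡l² ⟩
  + (l * l) - + (m * m)               ≡⟨ cong₂ _-_ (ℤₚ.pos-* l l) (ℤₚ.pos-* m m) ⟩
  + l *ℤ + l - + m *ℤ + m             ∎
  where
  open ≡-Reasoning
  x≡x+y-y : ∀ x y → x ≡ x +ℤ y - y
  x≡x+y-y x y = solveℤ (x ∷ y ∷ [])

+-double-product : ∀ {n l m} → n ≡ 2 * (l * m) → + n ≡ + 2 *ℤ + l *ℤ + m
+-double-product {n} {l} {m} n≡2lm = begin
  + n                   ≡⟨ cong +_ n≡2lm ⟩
  + (2 * (l * m))       ≡⟨ cong +_ (*-assoc 2 l m) ⟨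
  + (2 * l * m)         ≡⟨ ℤₚ.pos-* (2 * l) m ⟩
  + (2 * l) *ℤ + m      ≡⟨ cong (_*ℤ + m) (ℤₚ.pos-* 2 l) ⟩
  + 2 *ℤ + l *ℤ + m     ∎
  where open ≡-Reasoning

pythagorean-legs : ∀ {a b r ε c d} → IsUnit ε → c *ℤ c +ℤ d *ℤ d ≡ + r *ℤ + r → c *ℤ + b +ℤ d *ℤ + a ≡ ε →
  (∃ λ α → a ≡ 2 * α) → ∃ λ σ → ∃₂ λ l m → IsUnit σ × l * l + m * m ≡ r
    × c ≡ σ *ℤ (+ l *ℤ + l - + m *ℤ + m) × d ≡ - (σ *ℤ (+ 2 *ℤ + l *ℤ + m))
pythagorean-legs {a} {b} {r} {ε} {c} {d} ε-unit c²+d²≡r² cb+da≡ε (α , refl) with even⊎odd ∣ c ∣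
... | inj₁ (k , ∣c∣≡2k) with () ← common-divisor-of-unit {a = + (2 * α)} {+ b} {c} {d} ε-unit cb+da≡ε
                                    (ℤ∣.∣ᵤ⇒∣ {+ 2} {c} (divides k (trans ∣c∣≡2k (*-comm 2 k))))
                                    (ℤ∣.∣n⇒∣m*n d (ℤ∣.∣ᵤ⇒∣ {+ 2} {+ (2 * α)} (divides α (*-comm 2 α))))
... | inj₂ (k , ∣c∣≡1+2k) =
  let D′ , ∣d∣≡2D′ = odd²+square≡square⇒even {∣ c ∣} {∣ d ∣} {r} {k} ∣c∣²+∣d∣²≡r² ∣c∣≡1+2k
      l , m , ∣c∣+m²≡l² , D′≡lm , r≡l²+m² = pythagorean-parametrisation {∣ c ∣} {D′} {r} (∣c∣⊥ ∣d∣≡2D′)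
                                               (subst (λ D → ∣ c ∣ * ∣ c ∣ + D * D ≡ r * r) ∣d∣≡2D′ ∣c∣²+∣d∣²≡r²)
      σ , l′ , m′ , σ-unit , l′²+m′²≡l²+m² , c≡ , d≡ =
        signed-legs {c} {d} {l} {m} (+-difference-of-squares {∣ c ∣} {l} {m} ∣c∣+m²≡l²)
                                    (+-double-product {∣ d ∣} {l} {m} (trans ∣d∣≡2D′ (cong (2 *_) D′≡lm)))
  in σ , l′ , m′ , σ-unit , trans l′²+m′²≡l²+m² (sym r≡l²+m²) , c≡ , d≡
  where
  ∣c∣²+∣d∣²≡r² = ∣∣-sum-of-squares {c} {d} {r} c²+d²≡r²
  ∣c∣⊥ : ∀ {D′} → ∣ d ∣ ≡ 2 * D′ → Coprime ∣ c ∣ D′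
  ∣c∣⊥ {D′} ∣d∣≡2D′ {g} (g∣∣c∣ , g∣D′) =
    common-divisor-of-unit {a = + (2 * α)} {+ b} {c} {d} ε-unit cb+da≡ε (ℤ∣.∣ᵤ⇒∣ {+ g} {c} g∣∣c∣)
      (ℤ∣.∣m⇒∣m*n (+ (2 * α)) (ℤ∣.∣ᵤ⇒∣ {+ g} {d} (subst (g ∣_) (sym ∣d∣≡2D′) (∣-trans g∣D′ (n∣m*n 2)))))

parametrised-relations : ∀ a b c d σ ε s L M → σ *ℤ σ ≡ 1ℤ →
  c ≡ σ *ℤ (L *ℤ L - M *ℤ M) → d ≡ - (σ *ℤ (+ 2 *ℤ L *ℤ M)) → c *ℤ b +ℤ d *ℤ a ≡ ε → c *ℤ a - d *ℤ b ≡ s →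
  b *ℤ (L *ℤ L - M *ℤ M) - + 2 *ℤ a *ℤ L *ℤ M ≡ σ *ℤ ε × + 2 *ℤ b *ℤ L *ℤ M +ℤ a *ℤ (L *ℤ L - M *ℤ M) ≡ σ *ℤ s
parametrised-relations a b c d σ ε s L M σ²≡1 refl refl cb+da≡ε ca-db≡s = (begin
  b *ℤ (L *ℤ L - M *ℤ M) - + 2 *ℤ a *ℤ L *ℤ M                  ≡⟨ ℤₚ.*-identityˡ _ ⟨
  1ℤ *ℤ (b *ℤ (L *ℤ L - M *ℤ M) - + 2 *ℤ a *ℤ L *ℤ M)          ≡⟨ cong (_*ℤ (b *ℤ (L *ℤ L - M *ℤ M) - + 2 *ℤ a *ℤ L *ℤ M)) σ²≡1 ⟨
  σ *ℤ σ *ℤ (b *ℤ (L *ℤ L - M *ℤ M) - + 2 *ℤ a *ℤ L *ℤ M)      ≡⟨ solveℤ (a ∷ b ∷ σ ∷ L ∷ M ∷ []) ⟩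
  σ *ℤ (c *ℤ b +ℤ d *ℤ a)                                       ≡⟨ cong (σ *ℤ_) cb+da≡ε ⟩
  σ *ℤ ε                                                        ∎) , (begin
  + 2 *ℤ b *ℤ L *ℤ M +ℤ a *ℤ (L *ℤ L - M *ℤ M)                  ≡⟨ ℤₚ.*-identityˡ _ ⟨
  1ℤ *ℤ (+ 2 *ℤ b *ℤ L *ℤ M +ℤ a *ℤ (L *ℤ L - M *ℤ M))          ≡⟨ cong (_*ℤ (+ 2 *ℤ b *ℤ L *ℤ M +ℤ a *ℤ (L *ℤ L - M *ℤ M))) σ²≡1 ⟨
  σ *ℤ σ *ℤ (+ 2 *ℤ b *ℤ L *ℤ M +ℤ a *ℤ (L *ℤ L - M *ℤ M))      ≡⟨ solveℤ (a ∷ b ∷ σ ∷ L ∷ M ∷ []) ⟩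
  σ *ℤ (c *ℤ a - d *ℤ b)                                        ≡⟨ cong (σ *ℤ_) ca-db≡s ⟩
  σ *ℤ s                                                        ∎)
  where open ≡-Reasoning

negative-pell-parametrisation : ∀ {A a b s r} → Prime A → A % 4 ≡ 1 → b % 2 ≡ 1 → A ≡ a * a + b * b →
  s * s + 1 ≡ A * (r * r) →
  ∃₂ λ l m → IsUnit (+ b *ℤ (+ l *ℤ + l - + m *ℤ + m) - + 2 *ℤ + a *ℤ + l *ℤ + m)
           × ∣ + 2 *ℤ + b *ℤ + l *ℤ + m +ℤ + a *ℤ (+ l *ℤ + l - + m *ℤ + m) ∣ ≡ s × l * l + m * m ≡ r
negative-pell-parametrisation {A} {a} {b} {s} {r} pA A%4≡1 b%2≡1 A≡a²+b² s²+1≡Ar² =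
  let ε , c , d , ε-unit , c²+d²≡r² , cb+da≡ε , ca-db≡s = gaussian-decomposition {A} {a} {b} {s} {r} pA A≡a²+b² s²+1≡Ar²
      a-even = even-leg-of-sum-of-squares {a} {b} {A / 4} {b / 2} (trans (sym A≡a²+b²) (m%n≡r⇒m≡r+n*[m/n] {A} {4} A%4≡1))
                                                                   (m%n≡r⇒m≡r+n*[m/n] {b} {2} b%2≡1)
      σ , l , m , σ-unit , l²+m²≡r , c≡ , d≡ = pythagorean-legs {a} {b} {r} {ε} {c} {d} ε-unit c²+d²≡r² cb+da≡ε a-even
      E₁≡σε , E₂≡σs = parametrised-relations (+ a) (+ b) c d σ ε (+ s) (+ l) (+ m)
                                             (unit*unit≡1 σ-unit) c≡ d≡ cb+da≡ε ca-db≡s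
  in l , m , subst IsUnit (sym E₁≡σε) (unit-*-unit σ-unit ε-unit)
         , trans (cong ∣_∣ E₂≡σs) (∣unit*x∣≡∣x∣ (+ s) σ-unit) , l²+m²≡r

proposition1 : (A a b : ℕ) → Prime A → A % 4 ≡ 1 → 0 < a → 0 < b → b % 2 ≡ 1 →
    A ≡ a *ℕ a +ℕ b *ℕ b →
    ∃₂ λ (l m : ℕ) →
      ((+ b) *ℤ ((+ l) *ℤ (+ l) - (+ m) *ℤ (+ m)) - (+ 2) *ℤ (+ a) *ℤ (+ l) *ℤ (+ m) ≡ + 1
        ⊎ (+ b) *ℤ ((+ l) *ℤ (+ l) - (+ m) *ℤ (+ m)) - (+ 2) *ℤ (+ a) *ℤ (+ l) *ℤ (+ m) ≡ - (+ 1))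
      × IsMinimalPellSolution A
          (2 *ℕ ∣ (+ 2) *ℤ (+ b) *ℤ (+ l) *ℤ (+ m) +ℤ (+ a) *ℤ ((+ l) *ℤ (+ l) - (+ m) *ℤ (+ m)) ∣
             *ℕ (l *ℕ l +ℕ m *ℕ m))
proposition1 A a b pA A%4≡1 _ _ b%2≡1 A≡a²+b² =
  let x , minimal = minimal-pell-solution A (prime⇒irrationalSqrt pA)
      r , s , s²+1≡Ar² , x≡2sr = minimal-pell-solution-via-negative-pell {A} {x} pA A%4≡1 minimal
      l , m , E₁-unit , ∣E₂∣≡s , l²+m²≡r =
        negative-pell-parametrisation {A} {a} {b} {s} {r} pA A%4≡1 b%2≡1 A≡a²+b² s²+1≡Ar²
  in l , m , E₁-unit
     , subst (IsMinimalPellSolution A) (trans x≡2sr (cong₂ (λ s r → 2 * s * r) (sym ∣E₂∣≡s) (sym l²+m²≡r))) minimal
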